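{- Let $P$ be a natural unit interval order on $[n]$. Then $X_{\mathrm{inc}(P)}(\mathbf x,t)$ is a palindromic polynomial in $t$.
   Context: A natural unit interval order is a poset $P$ on $[n]$ such that (1) $x<_P y$ implies $x<y$ as integers, and (2) whenever the disjoint union of a chain $x<_P z$ and an element $y$ (incomparable to both) is an induced subposet of $P$, then $x<y<z$ as integers. $\mathrm{inc}(P)$ is the incomparability graph of $P$. For a graph $G$ on $[n]$, a proper coloring is $c:[n]\to\mathbb P$ with $c(i)\ne c(j)$ for $\{i,j\}\in E(G)$; $C(G)$ is the set of proper colorings, $\mathbf x_c=\prod_i x_{c(i)}$, $\mathrm{asc}(c)=|\{\{i,j\}\in E(G):i<j,\ c(i)<c(j)\}|$, and $X_G(\mathbf x,t)=\sum_{c\in C(G)}t^{\mathrm{asc}(c)}\mathbf x_c$. A polynomial $a_0+a_1t+\cdots+a_dt^d$ (here with coefficients symmetric functions, $a_d\neq 0$) is palindromic if $a_j=a_{d-j}$ for all $0\le j\le d$. -}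

module Defs where

open import Data.Nat using (ℕ; zero; suc; _<_; _≤_; _≡ᵇ_; _<ᵇ_)
open import Data.Bool using (Bool; true; false; _∧_; not; if_then_else_)
open import Data.Fin using (Fin; toℕ)
open import Data.Fin.Properties using (_≟_)
open import Data.Vec using (Vec; []; _∷_; lookup; tabulate)
open import Data.List using (List; []; _∷_; length; filterᵇ; map; concatMap; allFin; cartesianProduct)
open import Data.Product using (Σ; _×_; _,_; proj₁; proj₂)
open import Relation.Nullary.Decidable using (⌊_⌋)
open import Relation.Binary.PropositionalEquality using (_≡_)

-- A (strict) binary relation on [n] = Fin n, given as a Boolean matrix:
-- lt x y ≡ true  means  x <_P y.  (Fin n element k stands for k+1 ∈ [n].)
BRel : ℕ → Set
BRel n = Fin n → Fin n → Bool

IsStrictPoset : {n : ℕ} → BRel n → Set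
IsStrictPoset {n} lt =
  ((x : Fin n) → lt x x ≡ false) ×
  ((x y z : Fin n) → lt x y ≡ true → lt y z ≡ true → lt x z ≡ true)

Incomparable : {n : ℕ} → BRel n → Fin n → Fin n → Set
Incomparable lt x y = (lt x y ≡ false) × (lt y x ≡ false)

IsNaturalUnitIntervalOrder : {n : ℕ} → BRel n → Set
IsNaturalUnitIntervalOrder {n} lt =
  IsStrictPoset lt ×
  (((x y : Fin n) → lt x y ≡ true → toℕ x < toℕ y) ×
   ((x y z : Fin n) → lt x z ≡ true → Incomparable lt x y → Incomparable lt y z →
      (toℕ x < toℕ y) × (toℕ y < toℕ z)))

incAdj : {n : ℕ} → BRel n → Fin n → Fin n → Bool
incAdj lt i j = not ⌊ i ≟ j ⌋ ∧ (not (lt i j) ∧ not (lt j i))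

-- colorings with colors from {1,…,m} (Fin m; color k ↦ k+1), as vectors
Coloring : ℕ → ℕ → Set
Coloring n m = Vec (Fin m) n

allColorings : (n m : ℕ) → List (Coloring n m)
allColorings zero m = [] ∷ []
allColorings (suc n) m = concatMap (λ c → map (λ k → k ∷ c) (allFin m)) (allColorings n m)

pairs : (n : ℕ) → List (Fin n × Fin n)
pairs n = cartesianProduct (allFin n) (allFin n)

isProper : {n m : ℕ} → (Fin n → Fin n → Bool) → Coloring n m → Bool
isProper {n} adj c =
  length (filterᵇ (λ p → adj (proj₁ p) (proj₂ p) ∧
                         ⌊ lookup c (proj₁ p) ≟ lookup c (proj₂ p) ⌋) (pairs n)) ≡ᵇ 0

asc : {n m : ℕ} → (Fin n → Fin n → Bool) → Coloring n m → ℕ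
asc {n} adj c =
  length (filterᵇ (λ p → adj (proj₁ p) (proj₂ p) ∧
                         ((toℕ (proj₁ p) <ᵇ toℕ (proj₂ p)) ∧
                          (toℕ (lookup c (proj₁ p)) <ᵇ toℕ (lookup c (proj₂ p)))))
                  (pairs n))

multiplicity : {n m : ℕ} → Coloring n m → Fin m → ℕ
multiplicity {n} c k = length (filterᵇ (λ i → ⌊ lookup c i ≟ k ⌋) (allFin n))

hasContent : {n m : ℕ} → Coloring n m → Vec ℕ m → Bool
hasContent {n} {m} c α =
  length (filterᵇ (λ k → not (multiplicity c k ≡ᵇ lookup α k)) (allFin m)) ≡ᵇ 0

-- Coefficient of the monomial x_1^{α_1} ⋯ x_m^{α_m} in the coefficient a_j of t^j
-- of X_G(x,t), where G has adjacency adj.  (Any monomial only involves finitely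
-- many variables, so these numbers, over all m and α, determine a_j.)
coeff : {n : ℕ} → (Fin n → Fin n → Bool) → (m : ℕ) → Vec ℕ m → ℕ → ℕ
coeff {n} adj m α j =
  length (filterᵇ (λ c → isProper adj c ∧ (hasContent c α ∧ (asc adj c ≡ᵇ j)))
                  (allColorings n m))

-- d is the degree in t of X_G(x,t): a_d ≠ 0 (some proper coloring has d ascents)
-- and a_j = 0 for j > d (no proper coloring has more than d ascents).
IsTDegree : {n : ℕ} → (Fin n → Fin n → Bool) → ℕ → Set
IsTDegree {n} adj d =
  (Σ ℕ λ m → Σ (Coloring n m) λ c → (isProper adj c ≡ true) × (asc adj c ≡ d)) ×
  ((m : ℕ) (c : Coloring n m) → isProper adj c ≡ true → asc adj c ≤ d)

-- The degree d is the number of edges of inc(P): no proper colouring has more ascents, and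
-- the identity colouring has exactly that many. Reversing the colours, k ↦ m − 1 − k,
-- exchanges the ascents and descents of a proper colouring and reverses its content, so the
-- coefficient of x^α t^j equals that of x^(reverse α) t^(d − j). It remains to see that the
-- coefficients are symmetric in α; as reversal is a product of adjacent transpositions, it
-- suffices to exchange two consecutive colours a and a + 1.
--
-- List the vertices coloured a or a + 1 in increasing order and cut the list into runs of
-- consecutive adjacent vertices. If two vertices x < z of the list that are not neighbours in
-- it were adjacent, then for y between them the natural unit interval property would make
-- x, y, z a triangle coloured with a and a + 1 only. So the colours alternate along each run
-- and there are no other edges among these vertices. Exchanging a and a + 1 on the runs of
-- odd length is therefore an involution of the colourings that preserves properness and the
-- number of ascents and transposes the content: an odd run keeps its number of ascents when
-- its colours are exchanged, and an even run already uses a and a + 1 equally often.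

module Submission where

open import Defs
open import Algebra.Definitions using (Involutive)
open import Algebra.Properties.CommutativeSemigroup using (interchange)
open import Data.Bool using (Bool; true; false; _∧_; _∨_; not; if_then_else_; T)
open import Data.Bool.Properties using (∧-comm; ∧-idem; ∨-zeroʳ; not-involutive; T-≡)
open import Data.Empty using (⊥; ⊥-elim)
open import Data.Fin using (Fin; zero; suc; toℕ; opposite; fromℕ; fromℕ<; inject₁)
open import Data.Fin.Properties using (_≟_; toℕ-injective; suc-injective; opposite-involutive; opposite-prop; toℕ<n; toℕ-fromℕ<)
open import Data.List using (List; []; _∷_; _++_; length; map; concat; concatMap; filterᵇ; allFin; tabulate; cartesianProduct)
open import Data.List.Membership.Propositional using (_∈_; _∉_; lose)
open import Data.List.Membership.Propositional.Properties using (∈-allFin; ∈-cartesianProduct⁺; ∈-++⁺ʳ; ∈-concat⁺′; ∈-filter⁻; ∈-filter⁺)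
import Data.List.Membership.DecPropositional as DecMembership
open import Data.List.Properties using (map-tabulate; filter-some; filter-none)
open import Data.List.Relation.Unary.All as All using (All; []; _∷_)
import Data.List.Relation.Unary.All.Properties as All
open import Data.List.Relation.Unary.AllPairs as AllPairs using (AllPairs; []; _∷_)
import Data.List.Relation.Unary.AllPairs.Properties as AllPairs
open import Data.List.Relation.Unary.Any using (here; there)
open import Data.List.Relation.Unary.Linked as Linked using (Linked; []; [-]; _∷_)
open import Data.List.Relation.Unary.Linked.Properties using (AllPairs⇒Linked)
open import Data.Nat using (ℕ; zero; suc; _+_; _*_; _∸_; _≤_; _<_; _<ᵇ_; _≡ᵇ_; _<?_; z≤n; s≤s)
open import Data.Nat.Properties
  using (+-identityʳ; +-assoc; +-comm; +-mono-≤; +-commutativeSemigroup; ≤-refl; ≤-trans; ≤-reflexive; ≤-antisym; ≤-pred;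
         <-cmp; <⇒≯; <⇒≱; <⇒≤; <-irrefl; <-trans; n<1+n; ≤∧≢⇒<; m<n⇒m<1+n; 1+n≢n; m≤m+n; m≤n+m;
         ≡ᵇ⇒≡; m+n∸n≡m; ∸-cancelˡ-≡; ∸-cancelʳ-<; ∸-monoʳ-<)
import Data.Nat.Properties as ℕ
open import Data.Product using (_×_; _,_; proj₁; proj₂)
open import Data.Sum using (_⊎_; inj₁; inj₂)
open import Data.Vec using (Vec; []; _∷_; lookup; reverse; _∷ʳ_)
import Data.Vec as Vec
open import Data.Vec.Properties using (≡-dec; lookup∘tabulate; lookup-map; reverse-∷; tabulate-cong; tabulate∘lookup)
open import Function using (_∘_; id; _⇔_; mk⇔; Equivalence)
open import Relation.Binary using (DecidableEquality; tri<; tri≈; tri>)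
open import Relation.Binary.PropositionalEquality using (_≡_; _≢_; refl; sym; trans; cong; cong₂; subst; subst₂; module ≡-Reasoning)
open import Relation.Nullary using (¬_; Dec; yes; no)
open import Relation.Nullary.Decidable using (⌊_⌋; T?; isYes≗does; dec-true; dec-false; does-⇔)

private
  variable
    A B : Set

⟦_⟧ : Bool → ℕ
⟦ true ⟧ = 1
⟦ false ⟧ = 0

⟦∧⟧ : ∀ a b → ⟦ a ∧ b ⟧ ≡ ⟦ a ⟧ * ⟦ b ⟧
⟦∧⟧ true b = sym (+-identityʳ ⟦ b ⟧)
⟦∧⟧ false b = refl

⌊⌋-yes : (a? : Dec A) → A → ⌊ a? ⌋ ≡ true
⌊⌋-yes a? a = trans (isYes≗does a?) (dec-true a? a)

⌊⌋-no : (a? : Dec A) → ¬ A → ⌊ a? ⌋ ≡ false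
⌊⌋-no a? ¬a = trans (isYes≗does a?) (dec-false a? ¬a)

⌊⌋-⇔ : A ⇔ B → (a? : Dec A) (b? : Dec B) → ⌊ a? ⌋ ≡ ⌊ b? ⌋
⌊⌋-⇔ A⇔B a? b? = trans (isYes≗does a?) (trans (does-⇔ A⇔B a? b?) (sym (isYes≗does b?)))

⌊≟⌋-sym : ∀ {n} (x y : Fin n) → ⌊ x ≟ y ⌋ ≡ ⌊ y ≟ x ⌋
⌊≟⌋-sym x y = ⌊⌋-⇔ (mk⇔ sym sym) (x ≟ y) (y ≟ x)

-- Definitionally, m <ᵇ n is does (m <? n) and m ≡ᵇ n is does (m ≟ n).
<ᵇ-⇔ : ∀ {m n m′ n′} → (m < n ⇔ m′ < n′) → (m <ᵇ n) ≡ (m′ <ᵇ n′)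
<ᵇ-⇔ {m} {n} {m′} {n′} iff = does-⇔ iff (m <? n) (m′ <? n′)

<ᵇ-yes : ∀ {m n} → m < n → (m <ᵇ n) ≡ true
<ᵇ-yes {m} {n} = dec-true (m <? n)

<ᵇ-no : ∀ {m n} → ¬ m < n → (m <ᵇ n) ≡ false
<ᵇ-no {m} {n} = dec-false (m <? n)

≡ᵇ-⇔ : ∀ {m n m′ n′} → (m ≡ n ⇔ m′ ≡ n′) → (m ≡ᵇ n) ≡ (m′ ≡ᵇ n′)
≡ᵇ-⇔ {m} {n} {m′} {n′} iff = does-⇔ iff (m ℕ.≟ n) (m′ ℕ.≟ n′)

≡ᵇ-yes : ∀ {m n} → m ≡ n → (m ≡ᵇ n) ≡ true
≡ᵇ-yes {m} {n} = dec-true (m ℕ.≟ n)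

≡ᵇ-witness : ∀ {m n} → (m ≡ᵇ n) ≡ true → m ≡ n
≡ᵇ-witness {m} {n} e = ≡ᵇ⇒≡ m n (subst T (sym e) _)

≡true-⇔ : {a b : Bool} → (a ≡ true ⇔ b ≡ true) → a ≡ b
≡true-⇔ {true} {true} _ = refl
≡true-⇔ {true} {false} iff = sym (Equivalence.to iff refl)
≡true-⇔ {false} {true} iff = Equivalence.from iff refl
≡true-⇔ {false} {false} _ = refl

module _ {m : ℕ} (ρ : Fin m → Fin m) (ρ-involutive : Involutive _≡_ ρ) where

  involution-injective : ∀ {x y} → ρ x ≡ ρ y → x ≡ y
  involution-injective {x} {y} eq = trans (sym (ρ-involutive x)) (trans (cong ρ eq) (ρ-involutive y))

  ⌊≟⌋-involution : ∀ x k → ⌊ ρ x ≟ k ⌋ ≡ ⌊ x ≟ ρ k ⌋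
  ⌊≟⌋-involution x k =
    ⌊⌋-⇔ (mk⇔ (λ { refl → sym (ρ-involutive x) }) (λ { refl → ρ-involutive k })) (ρ x ≟ k) (x ≟ ρ k)

  ⌊≟⌋-involution-cancel : ∀ x y → ⌊ ρ x ≟ ρ y ⌋ ≡ ⌊ x ≟ y ⌋
  ⌊≟⌋-involution-cancel x y = trans (⌊≟⌋-involution x (ρ y)) (cong (λ z → ⌊ x ≟ z ⌋) (ρ-involutive y))

∑ : List A → (A → ℕ) → ℕ
∑ [] f = 0
∑ (x ∷ xs) f = f x + ∑ xs f

count≡∑ : (p : A → Bool) (xs : List A) → length (filterᵇ p xs) ≡ ∑ xs (λ x → ⟦ p x ⟧)
count≡∑ p [] = refl
count≡∑ p (x ∷ xs) with p x
... | true = cong suc (count≡∑ p xs)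
... | false = count≡∑ p xs

filterᵇ-cong : {p q : A → Bool} (xs : List A) → (∀ x → p x ≡ q x) → filterᵇ p xs ≡ filterᵇ q xs
filterᵇ-cong [] eq = refl
filterᵇ-cong {p = p} {q} (x ∷ xs) eq with p x | q x | eq x
... | true | .true | refl = cong (x ∷_) (filterᵇ-cong xs eq)
... | false | .false | refl = filterᵇ-cong xs eq

count-cong : {p q : A → Bool} (xs : List A) → (∀ x → p x ≡ q x) → length (filterᵇ p xs) ≡ length (filterᵇ q xs)
count-cong xs eq = cong length (filterᵇ-cong xs eq)

∑-cong : (xs : List A) {f g : A → ℕ} → (∀ x → f x ≡ g x) → ∑ xs f ≡ ∑ xs g
∑-cong [] eq = refl
∑-cong (x ∷ xs) eq = cong₂ _+_ (eq x) (∑-cong xs eq)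

∑-zero : (xs : List A) {f : A → ℕ} → (∀ x → f x ≡ 0) → ∑ xs f ≡ 0
∑-zero [] eq = refl
∑-zero (x ∷ xs) eq = cong₂ _+_ (eq x) (∑-zero xs eq)

∑-++ : (xs ys : List A) (f : A → ℕ) → ∑ (xs ++ ys) f ≡ ∑ xs f + ∑ ys f
∑-++ [] ys f = refl
∑-++ (x ∷ xs) ys f = trans (cong (f x +_) (∑-++ xs ys f)) (sym (+-assoc (f x) _ _))

∑-map : (g : A → B) (xs : List A) (f : B → ℕ) → ∑ (map g xs) f ≡ ∑ xs (f ∘ g)
∑-map g [] f = refl
∑-map g (x ∷ xs) f = cong (f (g x) +_) (∑-map g xs f)

∑-concat : (xss : List (List A)) (f : A → ℕ) → ∑ (concat xss) f ≡ ∑ xss (λ xs → ∑ xs f)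
∑-concat [] f = refl
∑-concat (xs ∷ xss) f = trans (∑-++ xs (concat xss) f) (cong (∑ xs f +_) (∑-concat xss f))

∑-concatMap : (g : A → List B) (xs : List A) (f : B → ℕ) → ∑ (concatMap g xs) f ≡ ∑ xs (λ x → ∑ (g x) f)
∑-concatMap g xs f = trans (∑-concat (map g xs) f) (∑-map g xs (λ ys → ∑ ys f))

∑-+ : (xs : List A) (f g : A → ℕ) → ∑ xs (λ x → f x + g x) ≡ ∑ xs f + ∑ xs g
∑-+ [] f g = refl
∑-+ (x ∷ xs) f g = trans (cong (f x + g x +_) (∑-+ xs f g)) (interchange +-commutativeSemigroup (f x) (g x) _ _)

∑-*ʳ : (xs : List A) (f : A → ℕ) (k : ℕ) → ∑ xs (λ x → f x * k) ≡ ∑ xs f * k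
∑-*ʳ [] f k = refl
∑-*ʳ (x ∷ xs) f k = trans (cong (f x * k +_) (∑-*ʳ xs f k)) (sym (ℕ.*-distribʳ-+ k (f x) _))

∑-swap : (xs : List A) (ys : List B) (f : A → B → ℕ) → ∑ xs (λ x → ∑ ys (f x)) ≡ ∑ ys (λ y → ∑ xs (λ x → f x y))
∑-swap [] ys f = sym (∑-zero ys (λ _ → refl))
∑-swap (x ∷ xs) ys f = trans (cong (∑ ys (f x) +_) (∑-swap xs ys f)) (sym (∑-+ ys (f x) _))

∑-filter : (p : A → Bool) (xs : List A) (f : A → ℕ) → ∑ (filterᵇ p xs) f ≡ ∑ xs (λ x → if p x then f x else 0)
∑-filter p [] f = refl
∑-filter p (x ∷ xs) f with p x
... | true = cong (f x +_) (∑-filter p xs f)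
... | false = ∑-filter p xs f

∑-partition : (p : A → Bool) (xs : List A) (f : A → ℕ) →
  ∑ xs f ≡ ∑ (filterᵇ p xs) f + ∑ xs (λ x → if p x then 0 else f x)
∑-partition p xs f = begin
    ∑ xs f
  ≡⟨ ∑-cong xs split ⟩
    ∑ xs (λ x → (if p x then f x else 0) + (if p x then 0 else f x))
  ≡⟨ ∑-+ xs _ _ ⟩
    ∑ xs (λ x → if p x then f x else 0) + ∑ xs (λ x → if p x then 0 else f x)
  ≡⟨ cong (_+ ∑ xs (λ x → if p x then 0 else f x)) (sym (∑-filter p xs f)) ⟩
    ∑ (filterᵇ p xs) f + ∑ xs (λ x → if p x then 0 else f x)
  ∎
  where
  open ≡-Reasoning
  split : ∀ x → f x ≡ (if p x then f x else 0) + (if p x then 0 else f x)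
  split x with p x
  ... | true = sym (+-identityʳ (f x))
  ... | false = refl

∑-mono : (xs : List A) {f g : A → ℕ} → (∀ x → f x ≤ g x) → ∑ xs f ≤ ∑ xs g
∑-mono [] le = z≤n
∑-mono (x ∷ xs) le = +-mono-≤ (le x) (∑-mono xs le)

∑-cartesianProduct : (xs : List A) (ys : List B) (f : A × B → ℕ) →
  ∑ (cartesianProduct xs ys) f ≡ ∑ xs (λ x → ∑ ys (λ y → f (x , y)))
∑-cartesianProduct [] ys f = refl
∑-cartesianProduct (x ∷ xs) ys f =
  trans (∑-++ (map (x ,_) ys) _ f) (cong₂ _+_ (∑-map (x ,_) ys f) (∑-cartesianProduct xs ys f))

∑-cong-∈ : (xs : List A) {f g : A → ℕ} → (∀ {x} → x ∈ xs → f x ≡ g x) → ∑ xs f ≡ ∑ xs g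
∑-cong-∈ [] eq = refl
∑-cong-∈ (x ∷ xs) eq = cong₂ _+_ (eq (here refl)) (∑-cong-∈ xs (eq ∘ there))

∑-∈-≤ : {xs : List A} {x : A} (f : A → ℕ) → x ∈ xs → f x ≤ ∑ xs f
∑-∈-≤ f (here refl) = m≤m+n _ _
∑-∈-≤ {xs = y ∷ _} f (there x∈) = ≤-trans (∑-∈-≤ f x∈) (m≤n+m _ (f y))

∑∑-partition : {V : Set} (p : V → Bool) (xs : List V) (h : V → V → ℕ) →
  ∑ xs (λ u → ∑ xs (h u)) ≡
  ∑ (filterᵇ p xs) (λ u → ∑ (filterᵇ p xs) (h u)) + ∑ xs (λ u → ∑ xs (λ v → if p u ∧ p v then 0 else h u v))
∑∑-partition {V} p xs h = begin
    ∑ xs (λ u → ∑ xs (h u))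
  ≡⟨ ∑-cong xs (λ u → trans (∑-cong xs (split u)) (∑-+ xs _ _)) ⟩
    ∑ xs (λ u → ∑ xs (inside u) + ∑ xs (outside u))
  ≡⟨ ∑-+ xs _ _ ⟩
    ∑ xs (λ u → ∑ xs (inside u)) + ∑ xs (λ u → ∑ xs (outside u))
  ≡⟨ cong (_+ ∑ xs (λ u → ∑ xs (outside u))) insideSum ⟩
    ∑ ys (λ u → ∑ ys (h u)) + ∑ xs (λ u → ∑ xs (outside u))
  ∎
  where
  open ≡-Reasoning
  ys : List V
  ys = filterᵇ p xs
  inside outside : V → V → ℕ
  inside u v = if p u ∧ p v then h u v else 0
  outside u v = if p u ∧ p v then 0 else h u v
  split : ∀ u v → h u v ≡ inside u v + outside u v
  split u v with p u ∧ p v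
  ... | true = sym (+-identityʳ (h u v))
  ... | false = refl
  insideSum : ∑ xs (λ u → ∑ xs (inside u)) ≡ ∑ ys (λ u → ∑ ys (h u))
  insideSum = begin
      ∑ xs (λ u → ∑ xs (inside u))
    ≡⟨ ∑-cong xs (λ u → ∑-cong xs (λ v → insideFactor u v)) ⟩
      ∑ xs (λ u → ∑ xs (λ v → if p u then (if p v then h u v else 0) else 0))
    ≡⟨ ∑-cong xs (λ u → ∑-if u) ⟩
      ∑ xs (λ u → if p u then ∑ ys (h u) else 0)
    ≡⟨ sym (∑-filter p xs (λ u → ∑ ys (h u))) ⟩
      ∑ ys (λ u → ∑ ys (h u))
    ∎
    where
    insideFactor : ∀ u v → inside u v ≡ (if p u then (if p v then h u v else 0) else 0)
    insideFactor u v with p u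
    ... | true = refl
    ... | false = refl
    ∑-if : ∀ u → ∑ xs (λ v → if p u then (if p v then h u v else 0) else 0) ≡ (if p u then ∑ ys (h u) else 0)
    ∑-if u with p u
    ... | true = sym (∑-filter p xs (h u))
    ... | false = ∑-zero xs (λ _ → refl)

Enumerates : DecidableEquality A → List A → Set
Enumerates _≟ᴬ_ xs = ∀ x → ∑ xs (λ y → ⟦ ⌊ y ≟ᴬ x ⌋ ⟧) ≡ 1

module _ {_≟ᴬ_ : DecidableEquality A} {xs : List A} (enum : Enumerates _≟ᴬ_ xs) where

  ∑-select : (f : A → ℕ) (x : A) → ∑ xs (λ y → ⟦ ⌊ y ≟ᴬ x ⌋ ⟧ * f y) ≡ f x
  ∑-select f x = trans (∑-cong xs same) (trans (∑-*ʳ xs _ (f x)) (trans (cong (_* f x) (enum x)) (+-identityʳ (f x))))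
    where
    same : ∀ y → ⟦ ⌊ y ≟ᴬ x ⌋ ⟧ * f y ≡ ⟦ ⌊ y ≟ᴬ x ⌋ ⟧ * f x
    same y with y ≟ᴬ x
    ... | yes refl = refl
    ... | no _ = refl

  ∑-involution : (σ : A → A) → Involutive _≡_ σ → (f : A → ℕ) → ∑ xs (f ∘ σ) ≡ ∑ xs f
  ∑-involution σ inv f = begin
      ∑ xs (λ x → f (σ x))
    ≡⟨ ∑-cong xs (λ x → sym (∑-select f (σ x))) ⟩
      ∑ xs (λ x → ∑ xs (λ y → ⟦ ⌊ y ≟ᴬ σ x ⌋ ⟧ * f y))
    ≡⟨ ∑-swap xs xs _ ⟩
      ∑ xs (λ y → ∑ xs (λ x → ⟦ ⌊ y ≟ᴬ σ x ⌋ ⟧ * f y))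
    ≡⟨ ∑-cong xs (λ y → ∑-cong xs (λ x → cong (λ b → ⟦ b ⟧ * f y) (⌊⌋-⇔ (transpose x y) (y ≟ᴬ σ x) (x ≟ᴬ σ y)))) ⟩
      ∑ xs (λ y → ∑ xs (λ x → ⟦ ⌊ x ≟ᴬ σ y ⌋ ⟧ * f y))
    ≡⟨ ∑-cong xs (λ y → trans (∑-*ʳ xs _ (f y)) (trans (cong (_* f y) (enum (σ y))) (+-identityʳ (f y)))) ⟩
      ∑ xs f
    ∎
    where
    open ≡-Reasoning
    transpose : ∀ x y → (y ≡ σ x) ⇔ (x ≡ σ y)
    transpose x y = mk⇔ (λ { refl → sym (inv x) }) (λ { refl → sym (inv y) })

  count-involution : (σ : A → A) → Involutive _≡_ σ → (p : A → Bool) →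
    length (filterᵇ (p ∘ σ) xs) ≡ length (filterᵇ p xs)
  count-involution σ inv p =
    trans (count≡∑ (p ∘ σ) xs) (trans (∑-involution σ inv (⟦_⟧ ∘ p)) (sym (count≡∑ p xs)))

∑-allFin-suc : ∀ n (h : Fin (suc n) → ℕ) → ∑ (allFin (suc n)) h ≡ h zero + ∑ (allFin n) (h ∘ suc)
∑-allFin-suc n h =
  cong (h zero +_) (trans (cong (λ ys → ∑ ys h) (sym (map-tabulate id suc))) (∑-map suc (allFin n) h))

allFin-enumerates : ∀ n → Enumerates _≟_ (allFin n)
allFin-enumerates (suc n) zero = trans (∑-allFin-suc n (λ y → ⟦ ⌊ y ≟ zero ⌋ ⟧)) (cong suc (∑-zero (allFin n) (λ _ → refl)))
allFin-enumerates (suc n) (suc x) = begin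
    ∑ (allFin (suc n)) (λ y → ⟦ ⌊ y ≟ suc x ⌋ ⟧)
  ≡⟨ ∑-allFin-suc n (λ y → ⟦ ⌊ y ≟ suc x ⌋ ⟧) ⟩
    ∑ (allFin n) (λ y → ⟦ ⌊ suc y ≟ suc x ⌋ ⟧)
  ≡⟨ ∑-cong (allFin n) (λ y → cong ⟦_⟧ (⌊⌋-⇔ (mk⇔ suc-injective (cong suc)) (suc y ≟ suc x) (y ≟ x))) ⟩
    ∑ (allFin n) (λ y → ⟦ ⌊ y ≟ x ⌋ ⟧)
  ≡⟨ allFin-enumerates n x ⟩
    1
  ∎
  where open ≡-Reasoning

_≟ᶜ_ : ∀ {n m} → DecidableEquality (Coloring n m)
_≟ᶜ_ = ≡-dec _≟_

⌊≟ᶜ⌋-∷ : ∀ {n m} (k k′ : Fin m) (c c′ : Coloring n m) → ⌊ (k ∷ c) ≟ᶜ (k′ ∷ c′) ⌋ ≡ ⌊ k ≟ k′ ⌋ ∧ ⌊ c ≟ᶜ c′ ⌋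
⌊≟ᶜ⌋-∷ k k′ c c′ with k ≟ k′ | c ≟ᶜ c′
... | yes _ | yes _ = refl
... | yes _ | no _ = refl
... | no _ | _ = refl

∑-allColorings-suc : ∀ n m (f : Coloring (suc n) m → ℕ) →
  ∑ (allColorings (suc n) m) f ≡ ∑ (allColorings n m) (λ c → ∑ (allFin m) (λ k → f (k ∷ c)))
∑-allColorings-suc n m f =
  trans (∑-concatMap _ (allColorings n m) f) (∑-cong (allColorings n m) (λ c → ∑-map (_∷ c) (allFin m) f))

allColorings-enumerates : ∀ n m → Enumerates _≟ᶜ_ (allColorings n m)
allColorings-enumerates zero m [] = refl
allColorings-enumerates (suc n) m (k ∷ c) = begin
    ∑ (allColorings (suc n) m) (λ c′ → ⟦ ⌊ c′ ≟ᶜ (k ∷ c) ⌋ ⟧)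
  ≡⟨ ∑-allColorings-suc n m _ ⟩
    ∑ (allColorings n m) (λ c′ → ∑ (allFin m) (λ k′ → ⟦ ⌊ (k′ ∷ c′) ≟ᶜ (k ∷ c) ⌋ ⟧))
  ≡⟨ ∑-cong (allColorings n m) (λ c′ → ∑-cong (allFin m) (λ k′ → trans (cong ⟦_⟧ (⌊≟ᶜ⌋-∷ k′ k c′ c)) (⟦∧⟧ ⌊ k′ ≟ k ⌋ ⌊ c′ ≟ᶜ c ⌋))) ⟩
    ∑ (allColorings n m) (λ c′ → ∑ (allFin m) (λ k′ → ⟦ ⌊ k′ ≟ k ⌋ ⟧ * ⟦ ⌊ c′ ≟ᶜ c ⌋ ⟧))
  ≡⟨ ∑-cong (allColorings n m) (λ c′ → trans (∑-*ʳ (allFin m) _ _) (trans (cong (_* _) (allFin-enumerates m k)) (+-identityʳ _))) ⟩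
    ∑ (allColorings n m) (λ c′ → ⟦ ⌊ c′ ≟ᶜ c ⌋ ⟧)
  ≡⟨ allColorings-enumerates n m c ⟩
    1
  ∎
  where open ≡-Reasoning

module _ {n : ℕ} (adj : Fin n → Fin n → Bool) where

  ProperColoring : ∀ {m} → Coloring n m → Set
  ProperColoring c = ∀ u v → adj u v ≡ true → lookup c u ≢ lookup c v

  conflict : ∀ {m} → Coloring n m → Fin n × Fin n → Bool
  conflict c (u , v) = adj u v ∧ ⌊ lookup c u ≟ lookup c v ⌋

  private
    ∈-pairs : ∀ u v → (u , v) ∈ pairs n
    ∈-pairs u v = ∈-cartesianProduct⁺ (∈-allFin u) (∈-allFin v)

  isProper⇒proper : ∀ {m} (c : Coloring n m) → isProper adj c ≡ true → ProperColoring c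
  isProper⇒proper c pr u v uv cu≡cv = <-irrefl refl (subst (0 <_) noConflicts someConflict)
    where
    conflicting : T (conflict c (u , v))
    conflicting = Equivalence.from T-≡ (cong₂ _∧_ uv (⌊⌋-yes (lookup c u ≟ lookup c v) cu≡cv))
    someConflict : 0 < length (filterᵇ (conflict c) (pairs n))
    someConflict = filter-some (T? ∘ conflict c) (lose (∈-pairs u v) conflicting)
    noConflicts : length (filterᵇ (conflict c) (pairs n)) ≡ 0
    noConflicts = ≡ᵇ-witness pr

  proper⇒isProper : ∀ {m} (c : Coloring n m) → ProperColoring c → isProper adj c ≡ true
  proper⇒isProper c proper = ≡ᵇ-yes (cong length (filter-none (T? ∘ conflict c) {pairs n} (All.tabulate λ {p} _ → noConflict p)))
    where
    noConflict : ∀ p → ¬ T (conflict c p)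
    noConflict (u , v) with adj u v in uv | lookup c u ≟ lookup c v
    ... | true | yes cu≡cv = ⊥-elim (proper u v uv cu≡cv)
    ... | true | no _ = λ ()
    ... | false | _ = λ ()

  isProper-⇔ : ∀ {m m′} (c : Coloring n m) (c′ : Coloring n m′) →
    (ProperColoring c ⇔ ProperColoring c′) → isProper adj c ≡ isProper adj c′
  isProper-⇔ c c′ iff = ≡true-⇔ (mk⇔ (proper⇒isProper c′ ∘ Equivalence.to iff ∘ isProper⇒proper c)
                                      (proper⇒isProper c ∘ Equivalence.from iff ∘ isProper⇒proper c′))

module _ {n : ℕ} (adj : Fin n → Fin n → Bool) where

  isEdge : Fin n × Fin n → Bool
  isEdge (u , v) = adj u v ∧ (toℕ u <ᵇ toℕ v)

  isAscent : ∀ {m} → (Fin n → Fin m) → Fin n × Fin n → Bool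
  isAscent κ (u , v) = adj u v ∧ ((toℕ u <ᵇ toℕ v) ∧ (toℕ (κ u) <ᵇ toℕ (κ v)))

  edgeCount : ℕ
  edgeCount = length (filterᵇ isEdge (pairs n))

  asc≤edgeCount : ∀ {m} (c : Coloring n m) → asc adj c ≤ edgeCount
  asc≤edgeCount c = subst₂ _≤_ (sym (count≡∑ (isAscent (lookup c)) (pairs n))) (sym (count≡∑ isEdge (pairs n)))
    (∑-mono (pairs n) (λ { (u , v) → ⟦∧∧⟧≤⟦∧⟧ (adj u v) (toℕ u <ᵇ toℕ v) _ }))
    where
    ⟦∧∧⟧≤⟦∧⟧ : ∀ a b c → ⟦ a ∧ (b ∧ c) ⟧ ≤ ⟦ a ∧ b ⟧
    ⟦∧∧⟧≤⟦∧⟧ true true true = ≤-refl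
    ⟦∧∧⟧≤⟦∧⟧ true true false = z≤n
    ⟦∧∧⟧≤⟦∧⟧ true false _ = z≤n
    ⟦∧∧⟧≤⟦∧⟧ false _ _ = z≤n

  identityColoring : Coloring n n
  identityColoring = Vec.tabulate id

  module _ (irreflexive : ∀ u → adj u u ≡ false) where

    identityColoring-proper : ProperColoring adj identityColoring
    identityColoring-proper u v uv eq with trans (sym (lookup∘tabulate id u)) (trans eq (lookup∘tabulate id v))
    ... | refl with () ← trans (sym uv) (irreflexive u)

    asc-identityColoring : asc adj identityColoring ≡ edgeCount
    asc-identityColoring = count-cong (pairs n) λ { (u , v) → cong (adj u v ∧_) (begin
        (toℕ u <ᵇ toℕ v) ∧ (toℕ (lookup identityColoring u) <ᵇ toℕ (lookup identityColoring v))
      ≡⟨ cong₂ (λ x y → (toℕ u <ᵇ toℕ v) ∧ (toℕ x <ᵇ toℕ y)) (lookup∘tabulate id u) (lookup∘tabulate id v) ⟩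
        (toℕ u <ᵇ toℕ v) ∧ (toℕ u <ᵇ toℕ v)
      ≡⟨ ∧-idem _ ⟩
        toℕ u <ᵇ toℕ v
      ∎) }
      where open ≡-Reasoning

    degree≡edgeCount : ∀ d → IsTDegree adj d → d ≡ edgeCount
    degree≡edgeCount d ((_ , c , _ , asc≡d) , bounded) = ≤-antisym
      (subst (_≤ edgeCount) asc≡d (asc≤edgeCount c))
      (subst (_≤ d) asc-identityColoring
        (bounded n identityColoring (proper⇒isProper adj identityColoring identityColoring-proper)))

-- Reversing the colours

opposite-<ᵇ : ∀ {m} (x y : Fin m) → (toℕ (opposite x) <ᵇ toℕ (opposite y)) ≡ (toℕ y <ᵇ toℕ x)
opposite-<ᵇ {m} x y = <ᵇ-⇔ (mk⇔ to from)
  where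
  to : toℕ (opposite x) < toℕ (opposite y) → toℕ y < toℕ x
  to lt = ≤-pred (∸-cancelʳ-< {suc (toℕ x)} {suc (toℕ y)} {m} (subst₂ _<_ (opposite-prop x) (opposite-prop y) lt))
  from : toℕ y < toℕ x → toℕ (opposite x) < toℕ (opposite y)
  from lt = subst₂ _<_ (sym (opposite-prop x)) (sym (opposite-prop y))
              (∸-monoʳ-< {m} {suc (toℕ x)} {suc (toℕ y)} (s≤s lt) (toℕ<n x))

lookup-∷ʳ-last : ∀ {n} (xs : Vec A n) (x : A) → lookup (xs ∷ʳ x) (fromℕ n) ≡ x
lookup-∷ʳ-last [] x = refl
lookup-∷ʳ-last (y ∷ xs) x = lookup-∷ʳ-last xs x

lookup-∷ʳ-inject₁ : ∀ {n} (xs : Vec A n) (x : A) (i : Fin n) → lookup (xs ∷ʳ x) (inject₁ i) ≡ lookup xs i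
lookup-∷ʳ-inject₁ (y ∷ xs) x zero = refl
lookup-∷ʳ-inject₁ (y ∷ xs) x (suc i) = lookup-∷ʳ-inject₁ xs x i

lookup-reverse-opposite : ∀ {n} (xs : Vec A n) (i : Fin n) → lookup (reverse xs) (opposite i) ≡ lookup xs i
lookup-reverse-opposite (x ∷ xs) zero rewrite reverse-∷ x xs = lookup-∷ʳ-last (reverse xs) x
lookup-reverse-opposite (x ∷ xs) (suc i) rewrite reverse-∷ x xs =
  trans (lookup-∷ʳ-inject₁ (reverse xs) x (opposite i)) (lookup-reverse-opposite xs i)

lookup-reverse : ∀ {n} (xs : Vec A n) (i : Fin n) → lookup (reverse xs) i ≡ lookup xs (opposite i)
lookup-reverse xs i =
  trans (cong (lookup (reverse xs)) (sym (opposite-involutive i))) (lookup-reverse-opposite xs (opposite i))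

⟦>ᵇ⟧+⟦<ᵇ⟧ : ∀ {x y} → x ≢ y → ⟦ y <ᵇ x ⟧ + ⟦ x <ᵇ y ⟧ ≡ 1
⟦>ᵇ⟧+⟦<ᵇ⟧ {x} {y} x≢y with <-cmp x y
... | tri< x<y _ _ rewrite <ᵇ-yes x<y | <ᵇ-no (<⇒≯ x<y) = refl
... | tri≈ _ x≡y _ = ⊥-elim (x≢y x≡y)
... | tri> _ _ y<x rewrite <ᵇ-yes y<x | <ᵇ-no (<⇒≯ y<x) = refl

reverseColors : ∀ {n m} → Coloring n m → Coloring n m
reverseColors = Vec.map opposite

reverseColors-involutive : ∀ {n m} → Involutive _≡_ (reverseColors {n} {m})
reverseColors-involutive [] = refl
reverseColors-involutive (k ∷ c) = cong₂ _∷_ (opposite-involutive k) (reverseColors-involutive c)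

lookup-reverseColors : ∀ {n m} (c : Coloring n m) (u : Fin n) → lookup (reverseColors c) u ≡ opposite (lookup c u)
lookup-reverseColors c u = lookup-map u opposite c

multiplicity-reverseColors : ∀ {n m} (c : Coloring n m) (k : Fin m) →
  multiplicity (reverseColors c) k ≡ multiplicity c (opposite k)
multiplicity-reverseColors {n} c k = count-cong (allFin n) λ u →
  trans (cong (λ x → ⌊ x ≟ k ⌋) (lookup-reverseColors c u)) (⌊≟⌋-involution opposite opposite-involutive (lookup c u) k)

hasContent-reverseColors : ∀ {n m} (c : Coloring n m) (α : Vec ℕ m) →
  hasContent (reverseColors c) (reverse α) ≡ hasContent c α
hasContent-reverseColors {n} {m} c α = cong (_≡ᵇ 0) (trans
  (count-cong (allFin m) λ k → cong₂ (λ x y → not (x ≡ᵇ y)) (multiplicity-reverseColors c k) (lookup-reverse α k))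
  (count-involution {xs = allFin m} (allFin-enumerates m) opposite opposite-involutive (λ k → not (multiplicity c k ≡ᵇ lookup α k))))

module _ {n : ℕ} (adj : Fin n → Fin n → Bool) {m : ℕ} where

  reverseColors-proper : (c : Coloring n m) → ProperColoring adj (reverseColors c) ⇔ ProperColoring adj c
  reverseColors-proper c = mk⇔
    (λ proper u v uv eq → proper u v uv
      (trans (lookup-reverseColors c u) (trans (cong opposite eq) (sym (lookup-reverseColors c v)))))
    (λ proper u v uv eq → proper u v uv
      (involution-injective opposite opposite-involutive (trans (sym (lookup-reverseColors c u)) (trans eq (lookup-reverseColors c v)))))

  -- In a proper colouring every edge is either an ascent or a descent.
  asc-reverseColors : (c : Coloring n m) → ProperColoring adj c →
    asc adj (reverseColors c) + asc adj c ≡ edgeCount adj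
  asc-reverseColors c proper = begin
      asc adj (reverseColors c) + asc adj c
    ≡⟨ cong₂ _+_ (count≡∑ (isAscent adj (lookup (reverseColors c))) (pairs n)) (count≡∑ (isAscent adj (lookup c)) (pairs n)) ⟩
      ∑ (pairs n) (⟦_⟧ ∘ isAscent adj (lookup (reverseColors c))) + ∑ (pairs n) (⟦_⟧ ∘ isAscent adj (lookup c))
    ≡⟨ sym (∑-+ (pairs n) _ _) ⟩
      ∑ (pairs n) (λ p → ⟦ isAscent adj (lookup (reverseColors c)) p ⟧ + ⟦ isAscent adj (lookup c) p ⟧)
    ≡⟨ ∑-cong (pairs n) (λ { (u , v) → ascentOrDescent u v }) ⟩
      ∑ (pairs n) (⟦_⟧ ∘ isEdge adj)
    ≡⟨ sym (count≡∑ (isEdge adj) (pairs n)) ⟩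
      edgeCount adj
    ∎
    where
    open ≡-Reasoning
    ascentOrDescent : ∀ u v → ⟦ isAscent adj (lookup (reverseColors c)) (u , v) ⟧ + ⟦ isAscent adj (lookup c) (u , v) ⟧ ≡ ⟦ isEdge adj (u , v) ⟧
    ascentOrDescent u v rewrite lookup-reverseColors c u | lookup-reverseColors c v | opposite-<ᵇ (lookup c u) (lookup c v)
      with adj u v in uv | toℕ u <ᵇ toℕ v
    ... | false | _ = refl
    ... | true | false = refl
    ... | true | true = ⟦>ᵇ⟧+⟦<ᵇ⟧ (proper u v uv ∘ toℕ-injective)

  coeff-reverseColors : (α : Vec ℕ m) (j : ℕ) → j ≤ edgeCount adj →
    coeff adj m (reverse α) (edgeCount adj ∸ j) ≡ coeff adj m α j
  coeff-reverseColors α j j≤E =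
    trans (sym (count-involution {xs = allColorings n m} (allColorings-enumerates n m) reverseColors reverseColors-involutive counted))
          (count-cong (allColorings n m) reversed)
    where
    E : ℕ
    E = edgeCount adj
    counted : Coloring n m → Bool
    counted c = isProper adj c ∧ (hasContent c (reverse α) ∧ (asc adj c ≡ᵇ E ∸ j))
    reversed : ∀ c → counted (reverseColors c) ≡ (isProper adj c ∧ (hasContent c α ∧ (asc adj c ≡ᵇ j)))
    reversed c rewrite isProper-⇔ adj (reverseColors c) c (reverseColors-proper c) | hasContent-reverseColors c α
      with isProper adj c in pr
    ... | false = refl
    ... | true = cong (hasContent c α ∧_) (≡ᵇ-⇔ (mk⇔
          (λ e → ∸-cancelˡ-≡ (asc≤edgeCount adj c) j≤E (trans (sym asc-rev) e))
          (λ e → trans asc-rev (cong (E ∸_) e))))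
      where
      asc-rev : asc adj (reverseColors c) ≡ E ∸ asc adj c
      asc-rev = trans (sym (m+n∸n≡m _ (asc adj c)))
                      (cong (_∸ asc adj c) (asc-reverseColors c (isProper⇒proper adj c pr)))

-- Adjacent transpositions

swapAt : ∀ {m} → ℕ → Vec A m → Vec A m
swapAt zero [] = []
swapAt zero (x ∷ []) = x ∷ []
swapAt zero (x ∷ y ∷ v) = y ∷ x ∷ v
swapAt (suc i) [] = []
swapAt (suc i) (x ∷ v) = x ∷ swapAt i v

SwapInvariant : ∀ {m} → (Vec A m → B) → Set
SwapInvariant {m = m} f = ∀ i → suc i < m → ∀ α → f (swapAt i α) ≡ f α

swapAt-∷ʳ : ∀ {m} (i : ℕ) (v : Vec A m) (x : A) → suc i < m → swapAt i (v ∷ʳ x) ≡ swapAt i v ∷ʳ x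
swapAt-∷ʳ zero (y ∷ []) x (s≤s ())
swapAt-∷ʳ zero (y ∷ z ∷ v) x _ = refl
swapAt-∷ʳ (suc i) (y ∷ v) x (s≤s i<m) = cong (y ∷_) (swapAt-∷ʳ i v x i<m)

swapInvariant-∷ʳ : ∀ {m} (f : Vec A (suc m) → B) → SwapInvariant f →
  ∀ x (v : Vec A m) → f (v ∷ʳ x) ≡ f (x ∷ v)
swapInvariant-∷ʳ f invariant x [] = refl
swapInvariant-∷ʳ f invariant x (y ∷ v) =
  trans (swapInvariant-∷ʳ (λ w → f (y ∷ w)) (λ i i<m α → invariant (suc i) (s≤s i<m) (y ∷ α)) x v)
        (invariant 0 (s≤s (s≤s z≤n)) (x ∷ y ∷ v))

swapInvariant-reverse : ∀ {m} (f : Vec A m → B) → SwapInvariant f → ∀ α → f (reverse α) ≡ f α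
swapInvariant-reverse f invariant [] = refl
swapInvariant-reverse {m = suc m} f invariant (x ∷ v) = begin
    f (reverse (x ∷ v))
  ≡⟨ cong f (reverse-∷ x v) ⟩
    f (reverse v ∷ʳ x)
  ≡⟨ swapInvariant-reverse (λ w → f (w ∷ʳ x)) invariantSnoc v ⟩
    f (v ∷ʳ x)
  ≡⟨ swapInvariant-∷ʳ f invariant x v ⟩
    f (x ∷ v)
  ∎
  where
  open ≡-Reasoning
  invariantSnoc : SwapInvariant (λ w → f (w ∷ʳ x))
  invariantSnoc i i<m α = trans (cong f (sym (swapAt-∷ʳ i α x i<m))) (invariant i (m<n⇒m<1+n i<m) (α ∷ʳ x))

transposeℕ : ℕ → ℕ → ℕ
transposeℕ zero zero = 1
transposeℕ zero (suc zero) = 0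
transposeℕ zero (suc (suc x)) = suc (suc x)
transposeℕ (suc i) zero = zero
transposeℕ (suc i) (suc x) = suc (transposeℕ i x)

transposeℕ-left : ∀ i → transposeℕ i i ≡ suc i
transposeℕ-left zero = refl
transposeℕ-left (suc i) = cong suc (transposeℕ-left i)

transposeℕ-right : ∀ i → transposeℕ i (suc i) ≡ i
transposeℕ-right zero = refl
transposeℕ-right (suc i) = cong suc (transposeℕ-right i)

transposeℕ-other : ∀ i x → x ≢ i → x ≢ suc i → transposeℕ i x ≡ x
transposeℕ-other zero zero x≢i _ = ⊥-elim (x≢i refl)
transposeℕ-other zero (suc zero) _ x≢1+i = ⊥-elim (x≢1+i refl)
transposeℕ-other zero (suc (suc x)) _ _ = refl
transposeℕ-other (suc i) zero _ _ = refl
transposeℕ-other (suc i) (suc x) x≢i x≢1+i = cong suc (transposeℕ-other i x (x≢i ∘ cong suc) (x≢1+i ∘ cong suc))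

lookup-swapAt : ∀ {m} (i : ℕ) (α : Vec A m) (k k′ : Fin m) →
  toℕ k′ ≡ transposeℕ i (toℕ k) → lookup (swapAt i α) k ≡ lookup α k′
lookup-swapAt zero (x ∷ []) zero zero ()
lookup-swapAt zero (x ∷ y ∷ α) zero (suc zero) _ = refl
lookup-swapAt zero (x ∷ y ∷ α) (suc zero) zero _ = refl
lookup-swapAt zero (x ∷ y ∷ α) (suc (suc k)) (suc (suc k′)) eq =
  cong (lookup α) (toℕ-injective (sym (ℕ.suc-injective (ℕ.suc-injective eq))))
lookup-swapAt (suc i) (x ∷ α) zero zero _ = refl
lookup-swapAt (suc i) (x ∷ α) (suc k) (suc k′) eq = lookup-swapAt i α k k′ (ℕ.suc-injective eq)

module Transposition {m : ℕ} (a b : Fin m) (b≡1+a : toℕ b ≡ suc (toℕ a)) where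

  τ : Fin m → Fin m
  τ x = if ⌊ x ≟ a ⌋ then b else if ⌊ x ≟ b ⌋ then a else x

  inPair : Fin m → Bool
  inPair x = ⌊ x ≟ a ⌋ ∨ ⌊ x ≟ b ⌋

  a≢b : a ≢ b
  a≢b a≡b = 1+n≢n (trans (sym b≡1+a) (cong toℕ (sym a≡b)))

  data PairView (x : Fin m) : Set where
    isA : x ≡ a → PairView x
    isB : x ≡ b → PairView x
    neither : x ≢ a → x ≢ b → PairView x

  pairView : ∀ x → PairView x
  pairView x with x ≟ a | x ≟ b
  ... | yes x≡a | _ = isA x≡a
  ... | no _ | yes x≡b = isB x≡b
  ... | no x≢a | no x≢b = neither x≢a x≢b

  τ-a : τ a ≡ b
  τ-a rewrite ⌊⌋-yes (a ≟ a) refl = refl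

  τ-b : τ b ≡ a
  τ-b rewrite ⌊⌋-no (b ≟ a) (a≢b ∘ sym) | ⌊⌋-yes (b ≟ b) refl = refl

  τ-outside : ∀ {x} → x ≢ a → x ≢ b → τ x ≡ x
  τ-outside x≢a x≢b rewrite ⌊⌋-no (_ ≟ a) x≢a | ⌊⌋-no (_ ≟ b) x≢b = refl

  inPair-a : inPair a ≡ true
  inPair-a rewrite ⌊⌋-yes (a ≟ a) refl = refl

  inPair-b : inPair b ≡ true
  inPair-b rewrite ⌊⌋-yes (b ≟ b) refl = ∨-zeroʳ _

  inPair-outside : ∀ {x} → x ≢ a → x ≢ b → inPair x ≡ false
  inPair-outside x≢a x≢b rewrite ⌊⌋-no (_ ≟ a) x≢a | ⌊⌋-no (_ ≟ b) x≢b = refl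

  τ-involutive : Involutive _≡_ τ
  τ-involutive x with pairView x
  ... | isA refl rewrite τ-a = τ-b
  ... | isB refl rewrite τ-b = τ-a
  ... | neither x≢a x≢b rewrite τ-outside x≢a x≢b = τ-outside x≢a x≢b

  inPair-τ : ∀ x → inPair (τ x) ≡ inPair x
  inPair-τ x with pairView x
  ... | isA refl rewrite τ-a | inPair-a = inPair-b
  ... | isB refl rewrite τ-b | inPair-b = inPair-a
  ... | neither x≢a x≢b rewrite τ-outside x≢a x≢b = refl

  τ-fixes-outside : ∀ x → inPair x ≡ false → τ x ≡ x
  τ-fixes-outside x out with pairView x
  ... | isA refl with () ← trans (sym out) inPair-a
  ... | isB refl with () ← trans (sym out) inPair-b
  ... | neither x≢a x≢b = τ-outside x≢a x≢b

  τ-other : ∀ x y → inPair x ≡ true → inPair y ≡ true → x ≢ y → y ≡ τ x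
  τ-other x y x∈ y∈ x≢y with pairView x | pairView y
  ... | isA refl | isA refl = ⊥-elim (x≢y refl)
  ... | isA refl | isB refl = sym τ-a
  ... | isB refl | isA refl = sym τ-b
  ... | isB refl | isB refl = ⊥-elim (x≢y refl)
  ... | neither x≢a x≢b | _ with () ← trans (sym x∈) (inPair-outside x≢a x≢b)
  ... | _ | neither y≢a y≢b with () ← trans (sym y∈) (inPair-outside y≢a y≢b)

  -- Since b = a + 1, no colour lies strictly between a and b.
  outside-<-a⇔b : ∀ {x} → x ≢ a → x ≢ b → (toℕ x < toℕ a ⇔ toℕ x < toℕ b) × (toℕ a < toℕ x ⇔ toℕ b < toℕ x)
  outside-<-a⇔b {x} x≢a x≢b = mk⇔ x<a⇒x<b x<b⇒x<a , mk⇔ a<x⇒b<x b<x⇒a<x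
    where
    a<b : toℕ a < toℕ b
    a<b = subst (toℕ a <_) (sym b≡1+a) (n<1+n _)
    x<a⇒x<b : toℕ x < toℕ a → toℕ x < toℕ b
    x<a⇒x<b x<a = <-trans x<a a<b
    x<b⇒x<a : toℕ x < toℕ b → toℕ x < toℕ a
    x<b⇒x<a x<b = ≤∧≢⇒< (≤-pred (subst (toℕ x <_) b≡1+a x<b)) (x≢a ∘ toℕ-injective)
    a<x⇒b<x : toℕ a < toℕ x → toℕ b < toℕ x
    a<x⇒b<x a<x = ≤∧≢⇒< (subst (_≤ toℕ x) (sym b≡1+a) a<x) (x≢b ∘ toℕ-injective ∘ sym)
    b<x⇒a<x : toℕ b < toℕ x → toℕ a < toℕ x
    b<x⇒a<x b<x = <-trans a<b b<x

  τ-<ᵇ-outside : ∀ x y → inPair x ≡ false →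
    ((toℕ (τ y) <ᵇ toℕ x) ≡ (toℕ y <ᵇ toℕ x)) × ((toℕ x <ᵇ toℕ (τ y)) ≡ (toℕ x <ᵇ toℕ y))
  τ-<ᵇ-outside x y out with pairView x
  ... | isA refl with () ← trans (sym out) inPair-a
  ... | isB refl with () ← trans (sym out) inPair-b
  ... | neither x≢a x≢b with outside-<-a⇔b x≢a x≢b | pairView y
  ...   | x<a⇔x<b , a<x⇔b<x | isA refl rewrite τ-a = sym (<ᵇ-⇔ a<x⇔b<x) , sym (<ᵇ-⇔ x<a⇔x<b)
  ...   | x<a⇔x<b , a<x⇔b<x | isB refl rewrite τ-b = <ᵇ-⇔ a<x⇔b<x , <ᵇ-⇔ x<a⇔x<b
  ...   | _ | neither y≢a y≢b rewrite τ-outside y≢a y≢b = refl , refl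

  flipIf : Bool → Fin m → Fin m
  flipIf true = τ
  flipIf false x = x

  flipIf-involutive : ∀ f → Involutive _≡_ (flipIf f)
  flipIf-involutive true = τ-involutive
  flipIf-involutive false x = refl

  inPair-flipIf : ∀ f x → inPair (flipIf f x) ≡ inPair x
  inPair-flipIf true = inPair-τ
  inPair-flipIf false x = refl

  flipIf-fixes-outside : ∀ f x → inPair x ≡ false → flipIf f x ≡ x
  flipIf-fixes-outside true = τ-fixes-outside
  flipIf-fixes-outside false x _ = refl

  flipIf-cancel-outside : ∀ f {x y} → inPair x ≡ false → x ≡ flipIf f y → x ≡ y
  flipIf-cancel-outside f {x} {y} out eq =
    trans (sym (flipIf-fixes-outside f x out)) (trans (cong (flipIf f) eq) (flipIf-involutive f y))

  flipIf-<ᵇ-outside : ∀ f x y → inPair x ≡ false →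
    ((toℕ (flipIf f y) <ᵇ toℕ x) ≡ (toℕ y <ᵇ toℕ x)) × ((toℕ x <ᵇ toℕ (flipIf f y)) ≡ (toℕ x <ᵇ toℕ y))
  flipIf-<ᵇ-outside true x y = τ-<ᵇ-outside x y
  flipIf-<ᵇ-outside false x y _ = refl , refl

  toℕ-τ : ∀ k → toℕ (τ k) ≡ transposeℕ (toℕ a) (toℕ k)
  toℕ-τ k with pairView k
  ... | isA refl rewrite τ-a = trans b≡1+a (sym (transposeℕ-left (toℕ a)))
  ... | isB refl rewrite τ-b | b≡1+a = sym (transposeℕ-right (toℕ a))
  ... | neither k≢a k≢b rewrite τ-outside k≢a k≢b =
    sym (transposeℕ-other (toℕ a) (toℕ k) (k≢a ∘ toℕ-injective) (λ k≡1+a → k≢b (toℕ-injective (trans k≡1+a (sym b≡1+a)))))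

  lookup-swapAt-τ : (α : Vec A m) (k : Fin m) → lookup (swapAt (toℕ a) α) k ≡ lookup α (τ k)
  lookup-swapAt-τ α k = lookup-swapAt (toℕ a) α k (τ k) (toℕ-τ k)

-- Runs

Linked-All : {P : A → Set} {R : A → A → Set} {xs : List A} → All P xs → Linked R xs →
  Linked (λ x y → P x × P y × R x y) xs
Linked-All _ [] = []
Linked-All _ [-] = [-]
Linked-All (px ∷ pys@(py ∷ _)) (r ∷ rs) = (px , py , r) ∷ Linked-All pys rs

allFin-sorted : ∀ n → AllPairs (λ x y → toℕ x < toℕ y) (allFin n)
allFin-sorted zero = []
allFin-sorted (suc n) = All.tabulate⁺ (λ _ → s≤s z≤n) ∷
  subst (AllPairs (λ x y → toℕ x < toℕ y)) (map-tabulate id suc) (AllPairs.map⁺ (AllPairs.map s≤s (allFin-sorted n)))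

AllPairs-++⁻ʳ : {R : A → A → Set} (xs : List A) {ys : List A} → AllPairs R (xs ++ ys) → AllPairs R ys
AllPairs-++⁻ʳ [] pairs = pairs
AllPairs-++⁻ʳ (x ∷ xs) (_ ∷ pairs) = AllPairs-++⁻ʳ xs pairs

++-disjoint : {xs ys : List A} {x : A} → AllPairs _≢_ (xs ++ ys) → x ∈ xs → x ∉ ys
++-disjoint {xs = x ∷ xs} (x≢ ∷ _) (here refl) x∈ys = All.lookup x≢ (∈-++⁺ʳ xs x∈ys) refl
++-disjoint {xs = _ ∷ xs} (_ ∷ distinct) (there x∈xs) x∈ys = ++-disjoint distinct x∈xs x∈ys

∑consecutive : (A → A → ℕ) → List A → ℕ
∑consecutive f [] = 0
∑consecutive f (x ∷ []) = 0
∑consecutive f (x ∷ y ∷ xs) = f x y + ∑consecutive f (y ∷ xs)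

∑consecutive-cong : {f g : A → A → ℕ} {xs : List A} → Linked (λ x y → f x y ≡ g x y) xs →
  ∑consecutive f xs ≡ ∑consecutive g xs
∑consecutive-cong [] = refl
∑consecutive-cong [-] = refl
∑consecutive-cong (eq ∷ eqs) = cong₂ _+_ eq (∑consecutive-cong eqs)

∑consecutive-cong-∈ : (xs : List A) {f g : A → A → ℕ} → (∀ {x y} → x ∈ xs → y ∈ xs → f x y ≡ g x y) →
  ∑consecutive f xs ≡ ∑consecutive g xs
∑consecutive-cong-∈ [] eq = refl
∑consecutive-cong-∈ (x ∷ []) eq = refl
∑consecutive-cong-∈ (x ∷ y ∷ xs) eq =
  cong₂ _+_ (eq (here refl) (there (here refl))) (∑consecutive-cong-∈ (y ∷ xs) (λ x∈ y∈ → eq (there x∈) (there y∈)))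

∑consecutive-zero : (xs : List A) → ∑consecutive (λ _ _ → 0) xs ≡ 0
∑consecutive-zero [] = refl
∑consecutive-zero (x ∷ []) = refl
∑consecutive-zero (x ∷ y ∷ xs) = ∑consecutive-zero (y ∷ xs)

module Runs {A : Set} (adjacent : A → A → Bool) where

  extendRun : Bool → A → List A × List (List A) → List A × List (List A)
  extendRun true y (r , rs) = y ∷ r , rs
  extendRun false y (r , rs) = [] , (y ∷ r) ∷ rs

  -- runsFrom x ys: the rest of the run that starts with x, followed by the later runs of x ∷ ys.
  runsFrom : A → List A → List A × List (List A)
  runsFrom x [] = [] , []
  runsFrom x (y ∷ ys) = extendRun (adjacent x y) y (runsFrom y ys)

  runs : List A → List (List A)
  runs [] = []
  runs (x ∷ xs) = (x ∷ proj₁ (runsFrom x xs)) ∷ proj₂ (runsFrom x xs)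

  concat-runsFrom : ∀ x ys → proj₁ (runsFrom x ys) ++ concat (proj₂ (runsFrom x ys)) ≡ ys
  concat-runsFrom x [] = refl
  concat-runsFrom x (y ∷ ys) with adjacent x y
  ... | true = cong (y ∷_) (concat-runsFrom y ys)
  ... | false = cong (y ∷_) (concat-runsFrom y ys)

  concat-runs : ∀ xs → concat (runs xs) ≡ xs
  concat-runs [] = refl
  concat-runs (x ∷ xs) = cong (x ∷_) (concat-runsFrom x xs)

  module _ {R : A → A → Set} where

    runsFrom-linked : ∀ {x ys} → Linked R (x ∷ ys) →
      Linked (λ u v → adjacent u v ≡ true × R u v) (x ∷ proj₁ (runsFrom x ys)) ×
      (∀ {r} → r ∈ proj₂ (runsFrom x ys) → Linked (λ u v → adjacent u v ≡ true × R u v) r)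
    runsFrom-linked {ys = []} _ = [-] , λ ()
    runsFrom-linked {x} {y ∷ ys} (Rxy ∷ linked) with adjacent x y in adj | runsFrom-linked linked
    ... | true | first , later = (adj , Rxy) ∷ first , later
    ... | false | first , later = [-] , λ { (here refl) → first ; (there r∈) → later r∈ }

    runs-linked : ∀ {xs} → Linked R xs → ∀ {r} → r ∈ runs xs → Linked (λ u v → adjacent u v ≡ true × R u v) r
    runs-linked {x ∷ xs} linked (here refl) = proj₁ (runsFrom-linked linked)
    runs-linked {x ∷ xs} linked (there r∈) = proj₂ (runsFrom-linked linked) r∈

  module _ (f : A → A → ℕ) (vanishes : ∀ x y → adjacent x y ≡ false → f x y ≡ 0) where

    ∑consecutive-runsFrom : ∀ x ys →
      ∑consecutive f (x ∷ ys) ≡ ∑consecutive f (x ∷ proj₁ (runsFrom x ys)) + ∑ (proj₂ (runsFrom x ys)) (∑consecutive f)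
    ∑consecutive-runsFrom x [] = refl
    ∑consecutive-runsFrom x (y ∷ ys) with adjacent x y in adj
    ... | true = trans (cong (f x y +_) (∑consecutive-runsFrom y ys)) (sym (+-assoc (f x y) _ _))
    ... | false = trans (cong (_+ ∑consecutive f (y ∷ ys)) (vanishes x y adj)) (∑consecutive-runsFrom y ys)

    ∑consecutive-runs : ∀ xs → ∑consecutive f xs ≡ ∑ (runs xs) (∑consecutive f)
    ∑consecutive-runs [] = refl
    ∑consecutive-runs (x ∷ xs) = ∑consecutive-runsFrom x xs

  ∑-runs : ∀ xs (h : A → ℕ) → ∑ xs h ≡ ∑ (runs xs) (λ r → ∑ r h)
  ∑-runs xs h = trans (cong (λ ys → ∑ ys h) (sym (concat-runs xs))) (∑-concat (runs xs) h)

  data NoLongEdges : List A → Set where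
    [] : NoLongEdges []
    [-] : ∀ {x} → NoLongEdges (x ∷ [])
    _∷_ : ∀ {x y ys} → All (λ z → adjacent x z ≡ false) ys → NoLongEdges (y ∷ ys) → NoLongEdges (x ∷ y ∷ ys)

  module _ (f : A → A → ℕ)
           (vanishesˡ : ∀ x y → adjacent x y ≡ false → f x y ≡ 0)
           (vanishesʳ : ∀ x y → adjacent x y ≡ false → f y x ≡ 0)
           (vanishes-diagonal : ∀ x → f x x ≡ 0) where

    private
      both : A → A → ℕ
      both x y = f x y + f y x

    ∑∑ : List A → ℕ
    ∑∑ xs = ∑ xs (λ u → ∑ xs (f u))

    ∑∑-noLongEdges : ∀ {xs} → NoLongEdges xs → ∑∑ xs ≡ ∑consecutive both xs
    ∑∑-noLongEdges [] = refl
    ∑∑-noLongEdges {x ∷ r} noLong = begin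
        (f x x + ∑ r (f x)) + ∑ r (λ u → f u x + ∑ r (f u))
      ≡⟨ cong₂ _+_ (cong (_+ ∑ r (f x)) (vanishes-diagonal x)) (∑-+ r (λ u → f u x) (λ u → ∑ r (f u))) ⟩
        ∑ r (f x) + (∑ r (λ u → f u x) + ∑∑ r)
      ≡⟨ sym (+-assoc (∑ r (f x)) _ _) ⟩
        (∑ r (f x) + ∑ r (λ u → f u x)) + ∑∑ r
      ≡⟨ cong (_+ ∑∑ r) (sym (∑-+ r (f x) (λ u → f u x))) ⟩
        ∑ r (both x) + ∑∑ r
      ≡⟨ fromFirst x r noLong ⟩
        ∑consecutive both (x ∷ r)
      ∎
      where
      open ≡-Reasoning
      fromFirst : ∀ x r → NoLongEdges (x ∷ r) → ∑ r (both x) + ∑∑ r ≡ ∑consecutive both (x ∷ r)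
      fromFirst x [] [-] = refl
      fromFirst x (y ∷ ys) (far ∷ noLong′) = cong₂ _+_ (trans (cong (both x y +_) farZero) (+-identityʳ _)) (∑∑-noLongEdges noLong′)
        where
        farZero : ∑ ys (both x) ≡ 0
        farZero = trans (∑-cong-∈ ys (λ z∈ → cong₂ _+_ (vanishesˡ x _ (All.lookup far z∈)) (vanishesʳ x _ (All.lookup far z∈))))
                        (∑-zero ys (λ _ → refl))

isOdd : ℕ → Bool
isOdd zero = false
isOdd (suc k) = not (isOdd k)

module RunParity {A : Set} (_≟ᴬ_ : DecidableEquality A) where
  open DecMembership _≟ᴬ_ using (_∈?_)

  runParity : List (List A) → A → Bool
  runParity [] x = false
  runParity (r ∷ rs) x = if ⌊ x ∈? r ⌋ then isOdd (length r) else runParity rs x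

  runParity-correct : ∀ {rs} → AllPairs _≢_ (concat rs) → ∀ {r x} → r ∈ rs → x ∈ r → runParity rs x ≡ isOdd (length r)
  runParity-correct {r ∷ rs} _ {x = x} (here refl) x∈r rewrite ⌊⌋-yes (x ∈? r) x∈r = refl
  runParity-correct {r ∷ rs} distinct {x = x} (there r′∈rs) x∈r′
    rewrite ⌊⌋-no (x ∈? r) (λ x∈r → ++-disjoint distinct x∈r (∈-concat⁺′ x∈r′ r′∈rs)) =
    runParity-correct (AllPairs-++⁻ʳ r distinct) r′∈rs x∈r′

-- Natural unit interval orders

module NaturalUnitIntervalOrder {n : ℕ} (P : BRel n) (nuio : IsNaturalUnitIntervalOrder P) where

  private
    transitive : ∀ x y z → P x y ≡ true → P y z ≡ true → P x z ≡ true
    transitive = proj₂ (proj₁ nuio)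
    natural : ∀ x y → P x y ≡ true → toℕ x < toℕ y
    natural = proj₁ (proj₂ nuio)
    unitInterval : ∀ x y z → P x z ≡ true → Incomparable P x y → Incomparable P y z → toℕ x < toℕ y × toℕ y < toℕ z
    unitInterval = proj₂ (proj₂ nuio)

  incAdj-irreflexive : ∀ u → incAdj P u u ≡ false
  incAdj-irreflexive u rewrite ⌊⌋-yes (u ≟ u) refl = refl

  incAdj-sym : ∀ u v → incAdj P u v ≡ incAdj P v u
  incAdj-sym u v rewrite ⌊≟⌋-sym u v = cong (not ⌊ v ≟ u ⌋ ∧_) (∧-comm (not (P u v)) (not (P v u)))

  below-above-or-between : ∀ p q y → P p q ≡ true →
    P p y ≡ true ⊎ P y q ≡ true ⊎ (toℕ p < toℕ y × toℕ y < toℕ q)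
  below-above-or-between p q y p<q with P y p in y<p
  ... | true = inj₂ (inj₁ (transitive y p q y<p p<q))
  ... | false with P q y in q<y
  ... | true = inj₁ (transitive p q y p<q q<y)
  ... | false with P p y in p<y
  ... | true = inj₁ refl
  ... | false with P y q in y<q
  ... | true = inj₂ (inj₁ refl)
  ... | false = inj₂ (inj₂ (unitInterval p y q p<q (p<y , y<p) (y<q , q<y)))

  <P-widen : ∀ {u v v′ w} → toℕ u ≤ toℕ v → toℕ v′ ≤ toℕ w → P v v′ ≡ true → P u w ≡ true
  <P-widen {u} {v} {v′} {w} u≤v v′≤w v<v′ with below-above-or-between v v′ u v<v′
  ... | inj₁ v<u = ⊥-elim (<⇒≱ (natural v u v<u) u≤v)
  ... | inj₂ (inj₂ (v<u , _)) = ⊥-elim (<⇒≱ v<u u≤v)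
  ... | inj₂ (inj₁ u<v′) with below-above-or-between u v′ w u<v′
  ...   | inj₁ u<w = u<w
  ...   | inj₂ (inj₁ w<v′) = ⊥-elim (<⇒≱ (natural w v′ w<v′) v′≤w)
  ...   | inj₂ (inj₂ (_ , w<v′)) = ⊥-elim (<⇒≱ w<v′ v′≤w)

  incAdj-narrow : ∀ {u v v′ w} → toℕ u ≤ toℕ v → toℕ v < toℕ v′ → toℕ v′ ≤ toℕ w →
    incAdj P u w ≡ true → incAdj P v v′ ≡ true
  incAdj-narrow {u} {v} {v′} {w} u≤v v<v′ v′≤w uw with P v v′ in v<v′ᴾ
  ... | true rewrite <P-widen u≤v v′≤w v<v′ᴾ | ∧-comm (not ⌊ u ≟ w ⌋) false with () ← uw
  ... | false with P v′ v in v′<v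
  ... | true = ⊥-elim (<⇒≯ v<v′ (natural v′ v v′<v))
  ... | false rewrite ⌊⌋-no (v ≟ v′) (λ { refl → <-irrefl refl v<v′ }) = refl

-- Swapping two consecutive colours

module AlternatingRuns {V : Set} {m : ℕ} (a b : Fin m) (b≡1+a : toℕ b ≡ suc (toℕ a)) (κ : V → Fin m) where
  open Transposition a b b≡1+a

  Alternating : List V → Set
  Alternating = Linked (λ x y → κ y ≡ τ (κ x))

  private
    pair-content : ∀ {x y} → κ y ≡ τ (κ x) → ∀ k →
      ⟦ ⌊ κ x ≟ k ⌋ ⟧ + ⟦ ⌊ κ y ≟ k ⌋ ⟧ ≡ ⟦ ⌊ κ x ≟ τ k ⌋ ⟧ + ⟦ ⌊ κ y ≟ τ k ⌋ ⟧
    pair-content {x} y≡τx k rewrite y≡τx | ⌊≟⌋-involution τ τ-involutive (κ x) k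
                                        | ⌊≟⌋-involution-cancel τ τ-involutive (κ x) k =
      +-comm ⟦ ⌊ κ x ≟ k ⌋ ⟧ _

  content-even : ∀ r → isOdd (length r) ≡ false → Alternating r → ∀ k →
    ∑ r (λ u → ⟦ ⌊ κ u ≟ k ⌋ ⟧) ≡ ∑ r (λ u → ⟦ ⌊ κ u ≟ τ k ⌋ ⟧)
  content-even [] _ _ k = refl
  content-even (x ∷ y ∷ r) even (y≡τx ∷ alternating) k = begin
      ⟦ ⌊ κ x ≟ k ⌋ ⟧ + (⟦ ⌊ κ y ≟ k ⌋ ⟧ + ∑ r (λ u → ⟦ ⌊ κ u ≟ k ⌋ ⟧))
    ≡⟨ sym (+-assoc ⟦ ⌊ κ x ≟ k ⌋ ⟧ _ _) ⟩
      (⟦ ⌊ κ x ≟ k ⌋ ⟧ + ⟦ ⌊ κ y ≟ k ⌋ ⟧) + ∑ r (λ u → ⟦ ⌊ κ u ≟ k ⌋ ⟧)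
    ≡⟨ cong₂ _+_ (pair-content y≡τx k) (content-even r (trans (sym (not-involutive (isOdd (length r)))) even) (tail alternating) k) ⟩
      (⟦ ⌊ κ x ≟ τ k ⌋ ⟧ + ⟦ ⌊ κ y ≟ τ k ⌋ ⟧) + ∑ r (λ u → ⟦ ⌊ κ u ≟ τ k ⌋ ⟧)
    ≡⟨ +-assoc ⟦ ⌊ κ x ≟ τ k ⌋ ⟧ _ _ ⟩
      ⟦ ⌊ κ x ≟ τ k ⌋ ⟧ + (⟦ ⌊ κ y ≟ τ k ⌋ ⟧ + ∑ r (λ u → ⟦ ⌊ κ u ≟ τ k ⌋ ⟧))
    ∎
    where
    open ≡-Reasoning
    tail : ∀ {y r} → Linked _ (y ∷ r) → Alternating r
    tail [-] = []
    tail (_ ∷ alternating) = alternating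

  -- On an odd alternating run the consecutive colour pairs are (c, τ c), (τ c, c), …, (τ c, c);
  -- transposing the colours exchanges each two neighbouring pairs, so the multiset of pairs is unchanged.
  consecutive-odd : ∀ r → isOdd (length r) ≡ true → Alternating r → (g : Fin m → Fin m → ℕ) →
    ∑consecutive (λ x y → g (τ (κ x)) (τ (κ y))) r ≡ ∑consecutive (λ x y → g (κ x) (κ y)) r
  consecutive-odd (x ∷ []) _ _ g = refl
  consecutive-odd (x ∷ y ∷ z ∷ r) odd (y≡τx ∷ z≡τy ∷ alternating) g = begin
      g (τ (κ x)) (τ (κ y)) + (g (τ (κ y)) (τ (κ z)) + ∑consecutive flipped (z ∷ r))
    ≡⟨ cong₂ (λ p q → g (τ (κ x)) p + (g p q + ∑consecutive flipped (z ∷ r))) τy≡x τz≡y ⟩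
      g (τ (κ x)) (κ x) + (g (κ x) (κ y) + ∑consecutive flipped (z ∷ r))
    ≡⟨ cong (λ s → g (τ (κ x)) (κ x) + (g (κ x) (κ y) + s))
            (consecutive-odd (z ∷ r) (trans (sym (not-involutive (isOdd (length (z ∷ r))))) odd) alternating g) ⟩
      g (τ (κ x)) (κ x) + (g (κ x) (κ y) + rest)
    ≡⟨ sym (+-assoc (g (τ (κ x)) (κ x)) _ rest) ⟩
      (g (τ (κ x)) (κ x) + g (κ x) (κ y)) + rest
    ≡⟨ cong (_+ rest) (+-comm (g (τ (κ x)) (κ x)) _) ⟩
      (g (κ x) (κ y) + g (τ (κ x)) (κ x)) + rest
    ≡⟨ +-assoc (g (κ x) (κ y)) _ rest ⟩
      g (κ x) (κ y) + (g (τ (κ x)) (κ x) + rest)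
    ≡⟨ cong₂ (λ p q → g (κ x) (κ y) + (g p q + rest)) (sym y≡τx) (sym z≡x) ⟩
      g (κ x) (κ y) + (g (κ y) (κ z) + rest)
    ∎
    where
    open ≡-Reasoning
    flipped : V → V → ℕ
    flipped x y = g (τ (κ x)) (τ (κ y))
    rest : ℕ
    rest = ∑consecutive (λ x y → g (κ x) (κ y)) (z ∷ r)
    τy≡x : τ (κ y) ≡ κ x
    τy≡x = trans (cong τ y≡τx) (τ-involutive (κ x))
    z≡x : κ z ≡ κ x
    z≡x = trans z≡τy τy≡x
    τz≡y : τ (κ z) ≡ κ y
    τz≡y = trans (cong τ z≡x) (sym y≡τx)

  content-flipIf : ∀ r → Alternating r → ∀ k →
    ∑ r (λ u → ⟦ ⌊ flipIf (isOdd (length r)) (κ u) ≟ k ⌋ ⟧) ≡ ∑ r (λ u → ⟦ ⌊ κ u ≟ τ k ⌋ ⟧)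
  content-flipIf r alternating k with isOdd (length r) in parity
  ... | true = ∑-cong r (λ u → cong ⟦_⟧ (⌊≟⌋-involution τ τ-involutive (κ u) k))
  ... | false = content-even r parity alternating k

  consecutive-flipIf : ∀ r → Alternating r → (g : Fin m → Fin m → ℕ) →
    ∑consecutive (λ x y → g (flipIf (isOdd (length r)) (κ x)) (flipIf (isOdd (length r)) (κ y))) r ≡
    ∑consecutive (λ x y → g (κ x) (κ y)) r
  consecutive-flipIf r alternating g with isOdd (length r) in parity
  ... | true = consecutive-odd r parity alternating g
  ... | false = refl

module AdjacentColourSwap {n : ℕ} (P : BRel n) (nuio : IsNaturalUnitIntervalOrder P)
                          {m : ℕ} (a b : Fin m) (b≡1+a : toℕ b ≡ suc (toℕ a)) where
  open NaturalUnitIntervalOrder P nuio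
  open Transposition a b b≡1+a
  open Runs (incAdj P)
  open RunParity {Fin n} _≟_

  private
    G : Fin n → Fin n → Bool
    G = incAdj P

  coloured : Coloring n m → Fin n → Bool
  coloured c u = inPair (lookup c u)

  pairVertices : Coloring n m → List (Fin n)
  pairVertices c = filterᵇ (coloured c) (allFin n)

  flag : Coloring n m → Fin n → Bool
  flag c = runParity (runs (pairVertices c))

  swapColours : Coloring n m → Coloring n m
  swapColours c = Vec.tabulate (λ u → flipIf (flag c u) (lookup c u))

  lookup-swapColours : ∀ c u → lookup (swapColours c) u ≡ flipIf (flag c u) (lookup c u)
  lookup-swapColours c u = lookup∘tabulate _ u

  coloured-swapColours : ∀ c u → coloured (swapColours c) u ≡ coloured c u
  coloured-swapColours c u = trans (cong inPair (lookup-swapColours c u)) (inPair-flipIf (flag c u) (lookup c u))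

  flag-swapColours : ∀ c u → flag (swapColours c) u ≡ flag c u
  flag-swapColours c u = cong (λ xs → runParity (runs xs) u) (filterᵇ-cong (allFin n) (coloured-swapColours c))

  swapColours-involutive : Involutive _≡_ swapColours
  swapColours-involutive c = trans (tabulate-cong twice) (tabulate∘lookup c)
    where
    twice : ∀ u → flipIf (flag (swapColours c) u) (lookup (swapColours c) u) ≡ lookup c u
    twice u rewrite flag-swapColours c u | lookup-swapColours c u = flipIf-involutive (flag c u) (lookup c u)

  swapColours-outside : ∀ c u → coloured c u ≡ false → lookup (swapColours c) u ≡ lookup c u
  swapColours-outside c u out = trans (lookup-swapColours c u) (flipIf-fixes-outside (flag c u) (lookup c u) out)

  <ᵇ-swapColours-outside : ∀ c u v → coloured c u ≡ false ⊎ coloured c v ≡ false →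
    (toℕ (lookup (swapColours c) u) <ᵇ toℕ (lookup (swapColours c) v)) ≡ (toℕ (lookup c u) <ᵇ toℕ (lookup c v))
  <ᵇ-swapColours-outside c u v (inj₁ out) rewrite swapColours-outside c u out | lookup-swapColours c v =
    proj₂ (flipIf-<ᵇ-outside (flag c v) (lookup c u) (lookup c v) out)
  <ᵇ-swapColours-outside c u v (inj₂ out) rewrite swapColours-outside c v out | lookup-swapColours c u =
    proj₁ (flipIf-<ᵇ-outside (flag c u) (lookup c v) (lookup c u) out)

  module _ (c : Coloring n m) where

    pairVertices-sorted : AllPairs (λ x y → toℕ x < toℕ y) (pairVertices c)
    pairVertices-sorted = AllPairs.filter⁺ (T? ∘ coloured c) (allFin-sorted n)

    ∈-pairVertices⁻ : ∀ {u} → u ∈ pairVertices c → coloured c u ≡ true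
    ∈-pairVertices⁻ u∈ = Equivalence.to T-≡ (proj₂ (∈-filter⁻ (T? ∘ coloured c) {xs = allFin n} u∈))

    ∈-pairVertices⁺ : ∀ {u} → coloured c u ≡ true → u ∈ pairVertices c
    ∈-pairVertices⁺ {u} col = ∈-filter⁺ (T? ∘ coloured c) (∈-allFin u) (Equivalence.from T-≡ col)

    swapColours-on-run : ∀ {r u} → r ∈ runs (pairVertices c) → u ∈ r →
      lookup (swapColours c) u ≡ flipIf (isOdd (length r)) (lookup c u)
    swapColours-on-run r∈ u∈ =
      trans (lookup-swapColours c _) (cong (λ f → flipIf f (lookup c _)) (runParity-correct distinct r∈ u∈))
      where
      distinct : AllPairs _≢_ (concat (runs (pairVertices c)))
      distinct = subst (AllPairs _≢_) (sym (concat-runs (pairVertices c)))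
                   (AllPairs.map (λ x<y x≡y → <-irrefl (cong toℕ x≡y) x<y) pairVertices-sorted)

    ∑-swapColours-on-run : ∀ {r} → r ∈ runs (pairVertices c) → (F : Fin n → Fin m → ℕ) →
      ∑ r (λ u → F u (lookup (swapColours c) u)) ≡ ∑ r (λ u → F u (flipIf (isOdd (length r)) (lookup c u)))
    ∑-swapColours-on-run {r} r∈ F = ∑-cong-∈ r (λ u∈ → cong (F _) (swapColours-on-run r∈ u∈))

    ∑consecutive-swapColours-on-run : ∀ {r} → r ∈ runs (pairVertices c) → (F : Fin n → Fin n → Fin m → Fin m → ℕ) →
      ∑consecutive (λ x y → F x y (lookup (swapColours c) x) (lookup (swapColours c) y)) r ≡
      ∑consecutive (λ x y → F x y (flipIf (isOdd (length r)) (lookup c x)) (flipIf (isOdd (length r)) (lookup c y))) r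
    ∑consecutive-swapColours-on-run {r} r∈ F =
      ∑consecutive-cong-∈ r (λ x∈ y∈ → cong₂ (F _ _) (swapColours-on-run r∈ x∈) (swapColours-on-run r∈ y∈))

  module OfProper (c : Coloring n m) (proper : ProperColoring G c) where
    open AlternatingRuns a b b≡1+a (lookup c)

    noColouredTriangle : ∀ {x y z} → coloured c x ≡ true → coloured c y ≡ true → coloured c z ≡ true →
      G x y ≡ true → G x z ≡ true → G y z ≡ true → ⊥
    noColouredTriangle cx cy cz xy xz yz =
      proper _ _ yz (trans (τ-other _ _ cx cy (proper _ _ xy)) (sym (τ-other _ _ cx cz (proper _ _ xz))))

    -- A long edge x–z would make x, its successor y and z a triangle coloured from {a, b}.
    noLongEdges-from : ∀ {ys} → AllPairs (λ x y → toℕ x < toℕ y) ys → (∀ {u} → u ∈ ys → coloured c u ≡ true) →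
      NoLongEdges ys
    noLongEdges-from [] _ = []
    noLongEdges-from (_ ∷ []) _ = [-]
    noLongEdges-from {x ∷ y ∷ zs} ((x<y ∷ _) ∷ sorted@(y<zs ∷ _)) col = All.tabulate far ∷ noLongEdges-from sorted (col ∘ there)
      where
      far : ∀ {z} → z ∈ zs → G x z ≡ false
      far {z} z∈ with G x z in xz
      ... | false = refl
      ... | true with y<z ← All.lookup y<zs z∈ = ⊥-elim
        (noColouredTriangle (col (here refl)) (col (there (here refl))) (col (there (there z∈)))
          (incAdj-narrow ≤-refl x<y (<⇒≤ y<z) xz) xz (incAdj-narrow (<⇒≤ x<y) y<z ≤-refl xz))

    noLongEdges : NoLongEdges (pairVertices c)
    noLongEdges = noLongEdges-from (pairVertices-sorted c) (∈-pairVertices⁻ c)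

    run-linked : ∀ {r} → r ∈ runs (pairVertices c) →
      Linked (λ x y → G x y ≡ true × coloured c x ≡ true × coloured c y ≡ true × toℕ x < toℕ y) r
    run-linked = runs-linked (Linked-All (All.tabulate (∈-pairVertices⁻ c)) (AllPairs⇒Linked (pairVertices-sorted c)))

    run-alternating : ∀ {r} → r ∈ runs (pairVertices c) → Alternating r
    run-alternating r∈ = Linked.map (λ (xy , cx , cy , _) → τ-other _ _ cx cy (proper _ _ xy)) (run-linked r∈)

    ∑∑-pairVertices : (f : Fin n → Fin n → ℕ) → (∀ x y → G x y ≡ false → f x y ≡ 0) →
      ∑ (pairVertices c) (λ u → ∑ (pairVertices c) (f u)) ≡ ∑ (runs (pairVertices c)) (∑consecutive (λ x y → f x y + f y x))
    ∑∑-pairVertices f vanishes =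
      trans (∑∑-noLongEdges f vanishes vanishesʳ (λ x → vanishes x x (incAdj-irreflexive x)) noLongEdges)
            (∑consecutive-runs _ (λ x y xy → cong₂ _+_ (vanishes x y xy) (vanishesʳ x y xy)) (pairVertices c))
      where
      vanishesʳ : ∀ x y → G x y ≡ false → f y x ≡ 0
      vanishesʳ x y xy = vanishes y x (trans (incAdj-sym y x) xy)

    conflicts-on-runs : ∀ {r} → r ∈ runs (pairVertices c) →
      ∑consecutive (λ x y → ⟦ conflict G (swapColours c) (x , y) ⟧ + ⟦ conflict G (swapColours c) (y , x) ⟧) r ≡ 0
    conflicts-on-runs {r} r∈ = begin
        ∑consecutive (λ x y → ⟦ conflict G (swapColours c) (x , y) ⟧ + ⟦ conflict G (swapColours c) (y , x) ⟧) r
      ≡⟨ ∑consecutive-swapColours-on-run c r∈ (λ x y X Y → ⟦ G x y ∧ ⌊ X ≟ Y ⌋ ⟧ + ⟦ G y x ∧ ⌊ Y ≟ X ⌋ ⟧) ⟩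
        ∑consecutive (λ x y → ⟦ G x y ∧ ⌊ recolour x ≟ recolour y ⌋ ⟧ + ⟦ G y x ∧ ⌊ recolour y ≟ recolour x ⌋ ⟧) r
      ≡⟨ ∑consecutive-cong (Linked.map (λ {x} {y} (xy , _) → noConflict {x} {y} xy) (run-linked r∈)) ⟩
        ∑consecutive (λ _ _ → 0) r
      ≡⟨ ∑consecutive-zero r ⟩
        0
      ∎
      where
      open ≡-Reasoning
      parity : Bool
      parity = isOdd (length r)
      recolour : Fin n → Fin m
      recolour x = flipIf parity (lookup c x)
      distinct : ∀ {x y} → G x y ≡ true → ⌊ recolour x ≟ recolour y ⌋ ≡ false
      distinct xy = ⌊⌋-no (_ ≟ _) (proper _ _ xy ∘ involution-injective (flipIf parity) (flipIf-involutive parity))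
      noConflict : ∀ {x y} → G x y ≡ true → ⟦ G x y ∧ ⌊ recolour x ≟ recolour y ⌋ ⟧ + ⟦ G y x ∧ ⌊ recolour y ≟ recolour x ⌋ ⟧ ≡ 0
      noConflict {x} {y} xy = cong₂ (λ p q → ⟦ p ⟧ + ⟦ q ⟧) (cong₂ _∧_ xy (distinct xy)) (cong₂ _∧_ yx (distinct yx))
        where
        yx : G y x ≡ true
        yx = trans (incAdj-sym y x) xy

    swapColours-proper : ProperColoring G (swapColours c)
    swapColours-proper u v uv eq with coloured c u in cu | coloured c v in cv
    ... | false | _ = proper u v uv
      (flipIf-cancel-outside (flag c v) cu (trans (sym (swapColours-outside c u cu)) (trans eq (lookup-swapColours c v))))
    ... | true | false = proper u v uv (sym
      (flipIf-cancel-outside (flag c u) cv (trans (sym (swapColours-outside c v cv)) (trans (sym eq) (lookup-swapColours c u)))))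
    ... | true | true = <-irrefl refl (≤-trans conflictCounted (≤-reflexive noConflicts))
      where
      conflicts : Fin n → Fin n → ℕ
      conflicts x y = ⟦ conflict G (swapColours c) (x , y) ⟧
      conflictCounted : 1 ≤ ∑ (pairVertices c) (λ x → ∑ (pairVertices c) (conflicts x))
      conflictCounted = subst (_≤ ∑ (pairVertices c) (λ x → ∑ (pairVertices c) (conflicts x))) (cong ⟦_⟧ (cong₂ _∧_ uv (⌊⌋-yes (_ ≟ _) eq)))
        (≤-trans (∑-∈-≤ (conflicts u) (∈-pairVertices⁺ c cv)) (∑-∈-≤ (λ x → ∑ (pairVertices c) (conflicts x)) (∈-pairVertices⁺ c cu)))
      noConflicts : ∑ (pairVertices c) (λ x → ∑ (pairVertices c) (conflicts x)) ≡ 0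
      noConflicts = trans (∑∑-pairVertices conflicts (λ x y xy → cong (λ b → ⟦ b ∧ ⌊ lookup (swapColours c) x ≟ lookup (swapColours c) y ⌋ ⟧) xy))
                          (trans (∑-cong-∈ (runs (pairVertices c)) conflicts-on-runs) (∑-zero (runs (pairVertices c)) (λ _ → refl)))

    multiplicity-swapColours : ∀ k → multiplicity (swapColours c) k ≡ multiplicity c (τ k)
    multiplicity-swapColours k = begin
        multiplicity (swapColours c) k
      ≡⟨ count≡∑ _ (allFin n) ⟩
        ∑ (allFin n) (hits (swapColours c) k)
      ≡⟨ ∑-partition (coloured c) (allFin n) _ ⟩
        ∑ (pairVertices c) (hits (swapColours c) k) + ∑ (allFin n) (λ u → if coloured c u then 0 else hits (swapColours c) k u)
      ≡⟨ cong₂ _+_ inside (∑-cong (allFin n) outside) ⟩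
        ∑ (pairVertices c) (hits c (τ k)) + ∑ (allFin n) (λ u → if coloured c u then 0 else hits c (τ k) u)
      ≡⟨ sym (∑-partition (coloured c) (allFin n) _) ⟩
        ∑ (allFin n) (hits c (τ k))
      ≡⟨ sym (count≡∑ _ (allFin n)) ⟩
        multiplicity c (τ k)
      ∎
      where
      open ≡-Reasoning
      hits : Coloring n m → Fin m → Fin n → ℕ
      hits c′ k′ u = ⟦ ⌊ lookup c′ u ≟ k′ ⌋ ⟧
      inside : ∑ (pairVertices c) (hits (swapColours c) k) ≡ ∑ (pairVertices c) (hits c (τ k))
      inside = begin
          ∑ (pairVertices c) (hits (swapColours c) k)
        ≡⟨ ∑-runs (pairVertices c) _ ⟩
          ∑ (runs (pairVertices c)) (λ r → ∑ r (hits (swapColours c) k))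
        ≡⟨ ∑-cong-∈ (runs (pairVertices c)) (λ {r} r∈ →
             trans (∑-swapColours-on-run c r∈ (λ _ X → ⟦ ⌊ X ≟ k ⌋ ⟧)) (content-flipIf r (run-alternating r∈) k)) ⟩
          ∑ (runs (pairVertices c)) (λ r → ∑ r (hits c (τ k)))
        ≡⟨ sym (∑-runs (pairVertices c) _) ⟩
          ∑ (pairVertices c) (hits c (τ k))
        ∎
      outside : ∀ u → (if coloured c u then 0 else hits (swapColours c) k u) ≡ (if coloured c u then 0 else hits c (τ k) u)
      outside u with coloured c u in cu
      ... | true = refl
      ... | false = cong ⟦_⟧ (begin
          ⌊ lookup (swapColours c) u ≟ k ⌋
        ≡⟨ cong (λ x → ⌊ x ≟ k ⌋) (swapColours-outside c u cu) ⟩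
          ⌊ lookup c u ≟ k ⌋
        ≡⟨ cong (λ x → ⌊ x ≟ k ⌋) (sym (τ-fixes-outside (lookup c u) cu)) ⟩
          ⌊ τ (lookup c u) ≟ k ⌋
        ≡⟨ ⌊≟⌋-involution τ τ-involutive (lookup c u) k ⟩
          ⌊ lookup c u ≟ τ k ⌋
        ∎)

    ascentPairs : (Fin n → Fin m) → Fin n → Fin n → ℕ
    ascentPairs κ x y = ⟦ isAscent G κ (x , y) ⟧ + ⟦ isAscent G κ (y , x) ⟧

    ∑consecutive-ascentPairs : ∀ κ {r} → r ∈ runs (pairVertices c) →
      ∑consecutive (ascentPairs κ) r ≡ ∑consecutive (λ x y → ⟦ toℕ (κ x) <ᵇ toℕ (κ y) ⟧) r
    ∑consecutive-ascentPairs κ r∈ = ∑consecutive-cong (Linked.map (λ {x} {y} (xy , _ , _ , x<y) → step {x} {y} xy x<y) (run-linked r∈))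
      where
      step : ∀ {x y} → G x y ≡ true → toℕ x < toℕ y → ascentPairs κ x y ≡ ⟦ toℕ (κ x) <ᵇ toℕ (κ y) ⟧
      step {x} {y} xy x<y rewrite incAdj-sym y x | xy | <ᵇ-yes x<y | <ᵇ-no (<⇒≯ x<y) = +-identityʳ _

    ascents-on-run : ∀ {r} → r ∈ runs (pairVertices c) →
      ∑consecutive (ascentPairs (lookup (swapColours c))) r ≡ ∑consecutive (ascentPairs (lookup c)) r
    ascents-on-run {r} r∈ = begin
        ∑consecutive (ascentPairs (lookup (swapColours c))) r
      ≡⟨ ∑consecutive-ascentPairs (lookup (swapColours c)) r∈ ⟩
        ∑consecutive (λ x y → ⟦ toℕ (lookup (swapColours c) x) <ᵇ toℕ (lookup (swapColours c) y) ⟧) r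
      ≡⟨ ∑consecutive-swapColours-on-run c r∈ (λ _ _ X Y → ⟦ toℕ X <ᵇ toℕ Y ⟧) ⟩
        ∑consecutive (λ x y → ⟦ toℕ (flipIf (isOdd (length r)) (lookup c x)) <ᵇ toℕ (flipIf (isOdd (length r)) (lookup c y)) ⟧) r
      ≡⟨ consecutive-flipIf r (run-alternating r∈) (λ X Y → ⟦ toℕ X <ᵇ toℕ Y ⟧) ⟩
        ∑consecutive (λ x y → ⟦ toℕ (lookup c x) <ᵇ toℕ (lookup c y) ⟧) r
      ≡⟨ sym (∑consecutive-ascentPairs (lookup c) r∈) ⟩
        ∑consecutive (ascentPairs (lookup c)) r
      ∎
      where open ≡-Reasoning

    asc-swapColours : asc G (swapColours c) ≡ asc G c
    asc-swapColours = begin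
        asc G (swapColours c)
      ≡⟨ asc≡∑∑ (swapColours c) ⟩
        ∑ (allFin n) (λ u → ∑ (allFin n) (ascent (swapColours c) u))
      ≡⟨ ∑∑-partition (coloured c) (allFin n) _ ⟩
        ∑∑pairVertices (swapColours c) + ∑ (allFin n) (λ u → ∑ (allFin n) (outside (swapColours c) u))
      ≡⟨ cong₂ _+_ inside (∑-cong (allFin n) λ u → ∑-cong (allFin n) (outside-swapColours u)) ⟩
        ∑∑pairVertices c + ∑ (allFin n) (λ u → ∑ (allFin n) (outside c u))
      ≡⟨ sym (∑∑-partition (coloured c) (allFin n) _) ⟩
        ∑ (allFin n) (λ u → ∑ (allFin n) (ascent c u))
      ≡⟨ sym (asc≡∑∑ c) ⟩
        asc G c
      ∎
      where
      open ≡-Reasoning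
      ascent : Coloring n m → Fin n → Fin n → ℕ
      ascent c′ u v = ⟦ isAscent G (lookup c′) (u , v) ⟧
      outside : Coloring n m → Fin n → Fin n → ℕ
      outside c′ u v = if coloured c u ∧ coloured c v then 0 else ascent c′ u v
      ∑∑pairVertices : Coloring n m → ℕ
      ∑∑pairVertices c′ = ∑ (pairVertices c) (λ u → ∑ (pairVertices c) (ascent c′ u))
      asc≡∑∑ : ∀ c′ → asc G c′ ≡ ∑ (allFin n) (λ u → ∑ (allFin n) (ascent c′ u))
      asc≡∑∑ c′ = trans (count≡∑ _ (pairs n)) (∑-cartesianProduct (allFin n) (allFin n) _)
      vanishes : ∀ c′ x y → G x y ≡ false → ascent c′ x y ≡ 0
      vanishes c′ x y xy rewrite xy = refl
      inside : ∑∑pairVertices (swapColours c) ≡ ∑∑pairVertices c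
      inside = trans (∑∑-pairVertices (ascent (swapColours c)) (vanishes (swapColours c)))
                     (trans (∑-cong-∈ (runs (pairVertices c)) ascents-on-run) (sym (∑∑-pairVertices (ascent c) (vanishes c))))
      outside-swapColours : ∀ u v → outside (swapColours c) u v ≡ outside c u v
      outside-swapColours u v with coloured c u in cu | coloured c v in cv
      ... | true | true = refl
      ... | false | _ = cong (λ b → ⟦ G u v ∧ ((toℕ u <ᵇ toℕ v) ∧ b) ⟧) (<ᵇ-swapColours-outside c u v (inj₁ cu))
      ... | true | false = cong (λ b → ⟦ G u v ∧ ((toℕ u <ᵇ toℕ v) ∧ b) ⟧) (<ᵇ-swapColours-outside c u v (inj₂ cv))

  swapColours-proper : ∀ c → ProperColoring G (swapColours c) ⇔ ProperColoring G c
  swapColours-proper c = mk⇔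
    (λ proper → subst (ProperColoring G) (swapColours-involutive c) (OfProper.swapColours-proper (swapColours c) proper))
    (OfProper.swapColours-proper c)

  hasContent-swapColours : ∀ c → ProperColoring G c → (α : Vec ℕ m) →
    hasContent (swapColours c) (swapAt (toℕ a) α) ≡ hasContent c α
  hasContent-swapColours c proper α = cong (_≡ᵇ 0) (trans
    (count-cong (allFin m) λ k →
      cong₂ (λ x y → not (x ≡ᵇ y)) (OfProper.multiplicity-swapColours c proper k) (lookup-swapAt-τ α k))
    (count-involution {xs = allFin m} (allFin-enumerates m) τ τ-involutive (λ k → not (multiplicity c k ≡ᵇ lookup α k))))

  coeff-swapAt : (α : Vec ℕ m) (j : ℕ) → coeff G m (swapAt (toℕ a) α) j ≡ coeff G m α j
  coeff-swapAt α j =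
    trans (sym (count-involution {xs = allColorings n m} (allColorings-enumerates n m) swapColours swapColours-involutive counted))
          (count-cong (allColorings n m) swapped)
    where
    counted : Coloring n m → Bool
    counted c = isProper G c ∧ (hasContent c (swapAt (toℕ a) α) ∧ (asc G c ≡ᵇ j))
    swapped : ∀ c → counted (swapColours c) ≡ (isProper G c ∧ (hasContent c α ∧ (asc G c ≡ᵇ j)))
    swapped c rewrite isProper-⇔ G (swapColours c) c (swapColours-proper c) with isProper G c in pr
    ... | false = refl
    ... | true rewrite hasContent-swapColours c (isProper⇒proper G c pr) α
                     | OfProper.asc-swapColours c (isProper⇒proper G c pr) = refl

coeff-swapInvariant : ∀ {n} (P : BRel n) → IsNaturalUnitIntervalOrder P → ∀ m j →
  SwapInvariant (λ (α : Vec ℕ m) → coeff (incAdj P) m α j)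
coeff-swapInvariant P nuio m j i 1+i<m α =
  subst (λ t → coeff (incAdj P) m (swapAt t α) j ≡ coeff (incAdj P) m α j) (toℕ-fromℕ< i<m)
        (AdjacentColourSwap.coeff-swapAt P nuio (fromℕ< i<m) (fromℕ< 1+i<m) b≡1+a α j)
  where
  i<m : i < m
  i<m = <-trans (n<1+n i) 1+i<m
  b≡1+a : toℕ (fromℕ< 1+i<m) ≡ suc (toℕ (fromℕ< i<m))
  b≡1+a = trans (toℕ-fromℕ< 1+i<m) (cong suc (sym (toℕ-fromℕ< i<m)))

theorem4p5 : (n : ℕ) (P : BRel n) → IsNaturalUnitIntervalOrder P →
    (d : ℕ) → IsTDegree (incAdj P) d →
    (j : ℕ) → j ≤ d → (m : ℕ) (α : Vec ℕ m) →
    coeff (incAdj P) m α j ≡ coeff (incAdj P) m α (d ∸ j)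
theorem4p5 n P nuio d degree j j≤d m α
  with refl ← degree≡edgeCount (incAdj P) (NaturalUnitIntervalOrder.incAdj-irreflexive P nuio) d degree = begin
    coeff (incAdj P) m α j
  ≡⟨ sym (coeff-reverseColors (incAdj P) α j j≤d) ⟩
    coeff (incAdj P) m (reverse α) (d ∸ j)
  ≡⟨ swapInvariant-reverse _ (coeff-swapInvariant P nuio m (d ∸ j)) α ⟩
    coeff (incAdj P) m α (d ∸ j)
  ∎
  where open ≡-Reasoning
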